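{- Let $k\ge1$, $H\in\mathbb{F}_q[x]$ nonzero, $D_1,D_2$ monic divisors of $H$, and $G\in\mathbb{F}_q[x]$. Then $$\sum_{A}\eta_k(A,D_1)\,\eta_k(G-A,D_2)=\begin{cases}|H|^k\,\eta_k(G,D),& D_1=D_2=D,\\ 0,&\text{otherwise},\end{cases}$$ where $A$ runs over a complete residue system modulo $H^k$.
   Context: Let $\mathbb{F}_q$ be a finite field with $q$ elements and fix a non-trivial homomorphism $\lambda:(\mathbb{F}_q,+)\to\mathbb{C}^*$. For nonzero $M\in\mathbb{F}_q[x]$ of degree $m\ge1$ and $A\in\mathbb{F}_q[x]$, let $t_M(A)$ be the coefficient of $x^{m-1}$ in the remainder of $A$ on division by $M$ (if $m=0$, $t_M(A)=0$), and $E(G,M)(A)=\lambda(t_M(GA))$. For $A,B$ not both zero, $(A,B)_k$ is the monic polynomial of the form $C^k$ of largest degree dividing both $A$ and $B$. For nonzero $D$, $\eta_k(G,D)=\sum_{R}E(G,D^k)(R)$, $R$ over a complete residue system modulo $D^k$ with $(R,D^k)_k=1$. $|A|=q^{\deg A}$. -}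

module Defs where

open import Level using (Level; _⊔_) renaming (suc to lsuc)
open import Data.Nat as ℕ using (ℕ; zero; suc; _∸_; _<_)
open import Data.List as List using (List; []; _∷_; length; map; concatMap; foldr)
open import Data.List.Membership.Propositional using (_∈_)
open import Data.List.Relation.Unary.Unique.Propositional using (Unique)
open import Data.Vec as Vec using (Vec; toList)
open import Data.Bool using (Bool; true; false; if_then_else_)
open import Data.Product using (Σ; ∃; _×_; _,_)
open import Data.Sum using (_⊎_)
open import Relation.Nullary using (Dec; yes; no; ¬_; does)
open import Relation.Binary.PropositionalEquality using (_≡_; _≢_)
open import Function.Bundles using (_⇔_)
open import Algebra.Bundles using (CommutativeRing)
open import Algebra.Structures using (IsCommutativeRing)

record FiniteField : Set₁ where
  infixl 7 _*_
  infixl 6 _+_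
  field
    Carrier  : Set
    _+_ _*_  : Carrier → Carrier → Carrier
    -_       : Carrier → Carrier
    0# 1#    : Carrier
    _⁻¹      : Carrier → Carrier
    isCommutativeRing : IsCommutativeRing _≡_ _+_ _*_ -_ 0# 1#
    0≢1      : 0# ≢ 1#
    ⁻¹-inverse : ∀ a → a ≢ 0# → a * (a ⁻¹) ≡ 1#
    _≟_      : (a b : Carrier) → Dec (a ≡ b)
    elements : List Carrier
    complete : ∀ a → a ∈ elements
    unique   : Unique elements

  q : ℕ
  q = length elements

-- Polynomials over F: coefficient lists, constant term first
-- (trailing zeros allowed; `norm` strips them).

module Poly (F : FiniteField) where
  open FiniteField F

  Pol : Set
  Pol = List Carrier

  isZ : Carrier → Bool
  isZ a = does (a ≟ 0#)

  norm : Pol → Pol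
  norm [] = []
  norm (a ∷ p) with norm p
  ... | [] = if isZ a then [] else a ∷ []
  ... | b ∷ r = a ∷ b ∷ r

  IsZero : Pol → Set
  IsZero p = norm p ≡ []

  _≈ₚ_ : Pol → Pol → Set
  p ≈ₚ r = norm p ≡ norm r

  -- degree (deg 0 := 0; only used for nonzero polynomials)
  deg : Pol → ℕ
  deg p = length (norm p) ∸ 1

  ∣_∣ₚ : Pol → ℕ
  ∣ p ∣ₚ = q ℕ.^ deg p

  coeff : ℕ → Pol → Carrier
  coeff i [] = 0#
  coeff zero (a ∷ p) = a
  coeff (suc i) (a ∷ p) = coeff i p

  lastC : Pol → Carrier
  lastC [] = 0#
  lastC (a ∷ []) = a
  lastC (a ∷ b ∷ p) = lastC (b ∷ p)

  lead : Pol → Carrier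
  lead p = lastC (norm p)

  Monic : Pol → Set
  Monic p = lead p ≡ 1#

  _+ₚ_ : Pol → Pol → Pol
  [] +ₚ r = r
  (a ∷ p) +ₚ [] = a ∷ p
  (a ∷ p) +ₚ (b ∷ r) = (a + b) ∷ (p +ₚ r)

  -ₚ_ : Pol → Pol
  -ₚ p = map -_ p

  _-ₚ_ : Pol → Pol → Pol
  p -ₚ r = p +ₚ (-ₚ r)

  scale : Carrier → Pol → Pol
  scale c p = map (c *_) p

  _*ₚ_ : Pol → Pol → Pol
  [] *ₚ r = []
  (a ∷ p) *ₚ r = scale a r +ₚ (0# ∷ (p *ₚ r))

  oneₚ : Pol
  oneₚ = 1# ∷ []

  _^ₚ_ : Pol → ℕ → Pol
  p ^ₚ zero = oneₚ
  p ^ₚ suc n = p *ₚ (p ^ₚ n)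

  shift : ℕ → Pol → Pol
  shift zero p = p
  shift (suc n) p = 0# ∷ shift n p

  _∣ₚ_ : Pol → Pol → Set
  D ∣ₚ H = ∃ λ Q → (Q *ₚ D) ≈ₚ H

  -- remainder of A on division by M (M nonzero), by long division;
  -- the fuel argument bounds the number of steps (length A suffices).
  remF : ℕ → Pol → Pol → Pol
  remF zero A M = norm A
  remF (suc n) A M with length (norm A) ℕ.<? length (norm M)
  ... | yes _ = norm A
  ... | no _  =
    remF n (norm A -ₚ shift (length (norm A) ∸ length (norm M))
                             (scale (lead A * (lead M ⁻¹)) (norm M))) M

  rem : Pol → Pol → Pol
  rem A M = remF (length A) A M

  t : Pol → Pol → Carrier
  t M A with deg M
  ... | zero = 0#
  ... | suc m = coeff m (rem A M)

  -- (R , M)_k = 1 : the monic k-th power of largest degree dividing both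
  -- is 1, i.e. every monic C with C^k ∣ R and C^k ∣ M has degree 0.
  kCoprime : ℕ → Pol → Pol → Set
  kCoprime k R M = ∀ C → Monic C → (C ^ₚ k) ∣ₚ R → (C ^ₚ k) ∣ₚ M → deg C ≡ 0

  -- canonical complete residue system modulo M: all polynomials of
  -- degree < deg M, given by their deg M coefficients
  allVecs : (n : ℕ) → List (Vec Carrier n)
  allVecs zero = Vec.[] ∷ []
  allVecs (suc n) = concatMap (λ a → map (a Vec.∷_) (allVecs n)) elements

  residues : Pol → List Pol
  residues M = map toList (allVecs (deg M))

module CharSums {c ℓ} (F : FiniteField) (R : CommutativeRing c ℓ)
                (λ' : FiniteField.Carrier F → CommutativeRing.Carrier R) where
  open FiniteField F using () renaming (Carrier to 𝔽)
  open Poly F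
  open CommutativeRing R renaming (Carrier to ℂ')

  sumR : List ℂ' → ℂ'
  sumR = foldr _+_ 0#

  fromℕ : ℕ → ℂ'
  fromℕ zero = 0#
  fromℕ (suc n) = 1# + fromℕ n

  E : Pol → Pol → Pol → ℂ'
  E G M A = λ' (t M (G *ₚ A))

  -- L is (the list of coefficient vectors of) a complete residue system
  -- modulo D^k restricted to those R with (R , D^k)_k = 1, without repetition
  IsEtaSystem : ℕ → Pol → List Pol → Set
  IsEtaSystem k D L =
    Unique L × (∀ r → (r ∈ L) ⇔ ((r ∈ residues (D ^ₚ k)) × kCoprime k r (D ^ₚ k)))

  η : ℕ → List Pol → Pol → Pol → ℂ'
  η k L G D = sumR (map (E G (D ^ₚ k)) L)

record IntegralDomain {c ℓ} (R : CommutativeRing c ℓ) : Set (c ⊔ ℓ) where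
  open CommutativeRing R
  field
    1≉0 : ¬ (1# ≈ 0#)
    noZeroDivisors : ∀ x y → (x * y) ≈ 0# → (x ≈ 0#) ⊎ (y ≈ 0#)

record NontrivialAdditiveCharacter {c ℓ} (F : FiniteField) (R : CommutativeRing c ℓ)
       (λ' : FiniteField.Carrier F → CommutativeRing.Carrier R) : Set (c ⊔ ℓ) where
  module F = FiniteField F
  open CommutativeRing R
  field
    hom-0 : λ' F.0# ≈ 1#
    hom-+ : ∀ a b → λ' (a F.+ b) ≈ (λ' a * λ' b)
    nontrivial : ∃ λ a → ¬ (λ' a ≈ 1#)

module _ {c ℓ} (F : FiniteField) (R : CommutativeRing c ℓ)
         (λ' : FiniteField.Carrier F → CommutativeRing.Carrier R) where
  open Poly F
  open CharSums F R λ'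
  open CommutativeRing R using (_*_)

  convSum : ℕ → Pol → Pol → Pol → Pol → List Pol → List Pol → CommutativeRing.Carrier R
  convSum k H G D₁ D₂ L₁ L₂ =
    sumR (map (λ A → η k L₁ A D₁ * η k L₂ (G -ₚ A) D₂) (residues (H ^ₚ k)))

{-# OPTIONS --safe #-}
module Submission where

-- Expanding both η's and using additivity of t, the sum becomes
--   Σ_{R₁,R₂} λ(t_{D₂^k}(G R₂)) · Σ_{A mod H^k} λ(t_{D₁^k}(A R₁) − t_{D₂^k}(A R₂)).
-- The inner sum is a character sum of a linear functional ψ of A, hence equals |H|^k if ψ
-- vanishes on 1, x, …, x^(deg H^k − 1) and 0 otherwise (λ is nontrivial and R is a domain).
-- As D₁^k and D₂^k divide H^k, ψ only depends on A mod H^k, so in the first case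
-- t_{D₁^k}(A R₁) = t_{D₂^k}(A R₂) for all A. Nondegeneracy of the pairing (A, R) ↦ t_M(A R)
-- turns this into R₁ D₂^k = R₂ D₁^k, and k-coprimality of R_i with D_i^k then forces
-- D₁ = D₂ and R₁ = R₂. Only this diagonal survives, contributing |H|^k η_k(G, D).

open import Defs
open import Data.Nat as ℕ using (ℕ; zero; suc; _≤_; _<_; z≤n; s≤s; _∸_; _^_)
import Data.Nat.Properties as ℕₚ
open import Data.List using (List; []; _∷_; length; map; foldr; concatMap; _++_)
import Data.List.Properties as Listₚ
open import Data.List.Membership.Propositional using (_∈_)
open import Data.List.Relation.Unary.Any using (here; there)
import Data.List.Relation.Unary.All as All
open import Data.List.Relation.Unary.AllPairs using (_∷_)
open import Data.List.Relation.Unary.Unique.Propositional using (Unique)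
open import Data.Product using (Σ; _×_; _,_; proj₁; proj₂)
open import Data.Sum using (_⊎_; inj₁; inj₂)
open import Data.Empty using (⊥-elim)
open import Relation.Nullary using (Dec; yes; no; ¬_)
open import Data.Bool using (if_then_else_)
open import Data.Vec as Vec using (toList)
import Data.Vec.Properties as Vecₚ
open import Data.List.Membership.Propositional.Properties using (∈-map⁻)
open import Function.Bundles using (Equivalence)
open import Relation.Binary.PropositionalEquality as ≡ using (_≡_; _≢_)
open import Relation.Binary.Bundles using (Setoid)
open import Algebra.Bundles using (AbelianGroup; CommutativeRing)
open import Algebra.Structures using (IsAbelianGroup)
import Algebra.Properties.Ring as RingProperties
import Algebra.Properties.CommutativeSemigroup as CommutativeSemigroupProperties
import Algebra.Properties.Semiring.Mult
import Relation.Binary.Reasoning.Setoid as SetoidReasoning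

module PolynomialAlgebra (F : FiniteField) where
  open ≡ using (refl; sym; trans; cong; cong₂; subst; module ≡-Reasoning)
  open FiniteField F
  open Poly F

  𝔽-ring : CommutativeRing _ _
  𝔽-ring = record { isCommutativeRing = isCommutativeRing }

  module 𝔽 where
    open CommutativeRing 𝔽-ring public
    open RingProperties ring public

  module 𝔽+ = CommutativeSemigroupProperties 𝔽.+-commutativeSemigroup

  ⁻¹-inverseˡ : ∀ a → a ≢ 0# → (a ⁻¹) * a ≡ 1#
  ⁻¹-inverseˡ a a≢0 = trans (𝔽.*-comm (a ⁻¹) a) (⁻¹-inverse a a≢0)

  *-cancel-≡0 : ∀ {a b} → a ≢ 0# → a * b ≡ 0# → b ≡ 0#
  *-cancel-≡0 {a} {b} a≢0 ab≡0 = begin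
    b                ≡⟨ sym (𝔽.*-identityˡ b) ⟩
    1# * b           ≡⟨ cong (_* b) (sym (⁻¹-inverseˡ a a≢0)) ⟩
    ((a ⁻¹) * a) * b ≡⟨ 𝔽.*-assoc (a ⁻¹) a b ⟩
    (a ⁻¹) * (a * b) ≡⟨ cong ((a ⁻¹) *_) ab≡0 ⟩
    (a ⁻¹) * 0#      ≡⟨ 𝔽.zeroʳ _ ⟩
    0#               ∎
    where open ≡-Reasoning

  *-≢0 : ∀ {a b} → a ≢ 0# → b ≢ 0# → a * b ≢ 0#
  *-≢0 a≢0 b≢0 ab≡0 = b≢0 (*-cancel-≡0 a≢0 ab≡0)

  infix 4 _∼_
  record _∼_ (p r : Pol) : Set where
    constructor mk∼
    field at : ∀ i → coeff i p ≡ coeff i r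
  open _∼_ public

  ∼-refl : ∀ {p} → p ∼ p
  ∼-refl = mk∼ λ _ → refl

  ∼-sym : ∀ {p r} → p ∼ r → r ∼ p
  ∼-sym e = mk∼ λ i → sym (at e i)

  ∼-trans : ∀ {p r s} → p ∼ r → r ∼ s → p ∼ s
  ∼-trans e f = mk∼ λ i → trans (at e i) (at f i)

  ∼-setoid : Setoid _ _
  ∼-setoid = record
    { Carrier = Pol ; _≈_ = _∼_
    ; isEquivalence = record { refl = ∼-refl ; sym = ∼-sym ; trans = ∼-trans } }

  ≡⇒∼ : ∀ {p r} → p ≡ r → p ∼ r
  ≡⇒∼ refl = ∼-refl

  ∷-cong : ∀ {a b p r} → a ≡ b → p ∼ r → (a ∷ p) ∼ (b ∷ r)
  ∷-cong e f = mk∼ λ { zero → e ; (suc i) → at f i }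

  ∷-injectiveˡ : ∀ {a b p r} → (a ∷ p) ∼ (b ∷ r) → a ≡ b
  ∷-injectiveˡ e = at e zero

  ∷-injectiveʳ : ∀ {a b p r} → (a ∷ p) ∼ (b ∷ r) → p ∼ r
  ∷-injectiveʳ e = mk∼ λ i → at e (suc i)

  []∼∷⁻ : ∀ {a p} → [] ∼ (a ∷ p) → (a ≡ 0#) × ([] ∼ p)
  []∼∷⁻ e = sym (at e zero) , mk∼ λ i → at e (suc i)

  []∼∷⁺ : ∀ {a p} → a ≡ 0# → [] ∼ p → [] ∼ (a ∷ p)
  []∼∷⁺ a≡0 e = mk∼ λ { zero → sym a≡0 ; (suc i) → at e i }

  coeff-+ₚ : ∀ i p r → coeff i (p +ₚ r) ≡ coeff i p + coeff i r
  coeff-+ₚ i [] r = sym (𝔽.+-identityˡ _)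
  coeff-+ₚ i (a ∷ p) [] = sym (𝔽.+-identityʳ _)
  coeff-+ₚ zero (a ∷ p) (b ∷ r) = refl
  coeff-+ₚ (suc i) (a ∷ p) (b ∷ r) = coeff-+ₚ i p r

  coeff--ₚ : ∀ i p → coeff i (-ₚ p) ≡ - coeff i p
  coeff--ₚ i [] = sym 𝔽.-0#≈0#
  coeff--ₚ zero (a ∷ p) = refl
  coeff--ₚ (suc i) (a ∷ p) = coeff--ₚ i p

  coeff-scale : ∀ i c p → coeff i (scale c p) ≡ c * coeff i p
  coeff-scale i c [] = sym (𝔽.zeroʳ c)
  coeff-scale zero c (a ∷ p) = refl
  coeff-scale (suc i) c (a ∷ p) = coeff-scale i c p

  coeff-shift : ∀ i n p → coeff (n ℕ.+ i) (shift n p) ≡ coeff i p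
  coeff-shift i zero p = refl
  coeff-shift i (suc n) p = coeff-shift i n p

  +ₚ-cong : ∀ {p p' r r'} → p ∼ p' → r ∼ r' → (p +ₚ r) ∼ (p' +ₚ r')
  +ₚ-cong {p} {p'} {r} {r'} e f = mk∼ λ i →
    trans (coeff-+ₚ i p r) (trans (cong₂ _+_ (at e i) (at f i)) (sym (coeff-+ₚ i p' r')))

  -ₚ-cong : ∀ {p p'} → p ∼ p' → (-ₚ p) ∼ (-ₚ p')
  -ₚ-cong {p} {p'} e = mk∼ λ i →
    trans (coeff--ₚ i p) (trans (cong -_ (at e i)) (sym (coeff--ₚ i p')))

  scale-cong : ∀ {c d p p'} → c ≡ d → p ∼ p' → scale c p ∼ scale d p'
  scale-cong {c} {d} {p} {p'} e f = mk∼ λ i →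
    trans (coeff-scale i c p) (trans (cong₂ _*_ e (at f i)) (sym (coeff-scale i d p')))

  shift-cong : ∀ n {p p'} → p ∼ p' → shift n p ∼ shift n p'
  shift-cong zero e = e
  shift-cong (suc n) e = ∷-cong refl (shift-cong n e)

  +ₚ-identityʳ : ∀ p → (p +ₚ []) ∼ p
  +ₚ-identityʳ [] = ∼-refl
  +ₚ-identityʳ (a ∷ p) = ∼-refl

  +ₚ-comm : ∀ p r → (p +ₚ r) ∼ (r +ₚ p)
  +ₚ-comm p r = mk∼ λ i →
    trans (coeff-+ₚ i p r) (trans (𝔽.+-comm _ _) (sym (coeff-+ₚ i r p)))

  +ₚ-assoc : ∀ p r s → ((p +ₚ r) +ₚ s) ∼ (p +ₚ (r +ₚ s))
  +ₚ-assoc p r s = mk∼ λ i → begin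
    coeff i ((p +ₚ r) +ₚ s)               ≡⟨ coeff-+ₚ i (p +ₚ r) s ⟩
    coeff i (p +ₚ r) + coeff i s          ≡⟨ cong (_+ coeff i s) (coeff-+ₚ i p r) ⟩
    (coeff i p + coeff i r) + coeff i s   ≡⟨ 𝔽.+-assoc _ _ _ ⟩
    coeff i p + (coeff i r + coeff i s)   ≡⟨ cong (coeff i p +_) (coeff-+ₚ i r s) ⟨
    coeff i p + coeff i (r +ₚ s)          ≡⟨ coeff-+ₚ i p (r +ₚ s) ⟨
    coeff i (p +ₚ (r +ₚ s))               ∎
    where open ≡-Reasoning

  -ₚ-inverseʳ : ∀ p → (p +ₚ (-ₚ p)) ∼ []
  -ₚ-inverseʳ p = mk∼ λ i →
    trans (coeff-+ₚ i p (-ₚ p)) (trans (cong (coeff i p +_) (coeff--ₚ i p)) (𝔽.-‿inverseʳ _))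

  +ₚ-isAbelianGroup : IsAbelianGroup _∼_ _+ₚ_ [] (-ₚ_)
  +ₚ-isAbelianGroup = record
    { isGroup = record
      { isMonoid = record
        { isSemigroup = record
          { isMagma = record
            { isEquivalence = Setoid.isEquivalence ∼-setoid ; ∙-cong = +ₚ-cong }
          ; assoc = +ₚ-assoc }
        ; identity = (λ _ → ∼-refl) , +ₚ-identityʳ }
      ; inverse = (λ p → ∼-trans (+ₚ-comm (-ₚ p) p) (-ₚ-inverseʳ p)) , -ₚ-inverseʳ
      ; ⁻¹-cong = -ₚ-cong }
    ; comm = +ₚ-comm }

  +ₚ-abelianGroup : AbelianGroup _ _
  +ₚ-abelianGroup = record { isAbelianGroup = +ₚ-isAbelianGroup }

  module ℙ+ = CommutativeSemigroupProperties (AbelianGroup.commutativeSemigroup +ₚ-abelianGroup)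

  scale-distrib-+ₚ : ∀ c p r → scale c (p +ₚ r) ∼ (scale c p +ₚ scale c r)
  scale-distrib-+ₚ c p r = mk∼ λ i → begin
    coeff i (scale c (p +ₚ r))                ≡⟨ coeff-scale i c (p +ₚ r) ⟩
    c * coeff i (p +ₚ r)                      ≡⟨ cong (c *_) (coeff-+ₚ i p r) ⟩
    c * (coeff i p + coeff i r)               ≡⟨ 𝔽.distribˡ _ _ _ ⟩
    c * coeff i p + c * coeff i r             ≡⟨ cong₂ _+_ (coeff-scale i c p) (coeff-scale i c r) ⟨
    coeff i (scale c p) + coeff i (scale c r) ≡⟨ coeff-+ₚ i (scale c p) (scale c r) ⟨
    coeff i (scale c p +ₚ scale c r)          ∎
    where open ≡-Reasoning

  scale-distrib-+ : ∀ c d p → scale (c + d) p ∼ (scale c p +ₚ scale d p)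
  scale-distrib-+ c d p = mk∼ λ i → begin
    coeff i (scale (c + d) p)                 ≡⟨ coeff-scale i (c + d) p ⟩
    (c + d) * coeff i p                       ≡⟨ 𝔽.distribʳ _ _ _ ⟩
    c * coeff i p + d * coeff i p             ≡⟨ cong₂ _+_ (coeff-scale i c p) (coeff-scale i d p) ⟨
    coeff i (scale c p) + coeff i (scale d p) ≡⟨ coeff-+ₚ i (scale c p) (scale d p) ⟨
    coeff i (scale c p +ₚ scale d p)          ∎
    where open ≡-Reasoning

  scale-scale : ∀ c d p → scale c (scale d p) ∼ scale (c * d) p
  scale-scale c d p = mk∼ λ i →
    trans (coeff-scale i c (scale d p)) (trans (cong (c *_) (coeff-scale i d p))
      (trans (sym (𝔽.*-assoc _ _ _)) (sym (coeff-scale i (c * d) p))))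

  scale-zero : ∀ p → scale 0# p ∼ []
  scale-zero p = mk∼ λ i → trans (coeff-scale i 0# p) (𝔽.zeroˡ _)

  scale-one : ∀ p → scale 1# p ∼ p
  scale-one p = mk∼ λ i → trans (coeff-scale i 1# p) (𝔽.*-identityˡ _)

  -ₚ≈scale-1 : ∀ p → (-ₚ p) ∼ scale (- 1#) p
  -ₚ≈scale-1 p = mk∼ λ i →
    trans (coeff--ₚ i p) (trans (sym (𝔽.-1*x≈-x _)) (sym (coeff-scale i (- 1#) p)))

  scale-const : ∀ c p → scale c p ∼ ((c ∷ []) *ₚ p)
  scale-const c p =
    ∼-sym (∼-trans (+ₚ-cong (∼-refl {scale c p}) (∼-sym ([]∼∷⁺ refl ∼-refl))) (+ₚ-identityʳ _))

  *ₚ-zeroˡ : ∀ {p} r → [] ∼ p → [] ∼ (p *ₚ r)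
  *ₚ-zeroˡ {[]} r e = ∼-refl
  *ₚ-zeroˡ {a ∷ p} r e with []∼∷⁻ e
  ... | a≡0 , p∼[] = ∼-sym (begin
    scale a r +ₚ (0# ∷ (p *ₚ r)) ≈⟨ +ₚ-cong (scale-cong a≡0 ∼-refl) (∷-cong refl (∼-sym (*ₚ-zeroˡ r p∼[]))) ⟩
    scale 0# r +ₚ (0# ∷ [])      ≈⟨ +ₚ-cong (scale-zero r) ∼-refl ⟩
    0# ∷ []                      ≈⟨ []∼∷⁺ refl ∼-refl ⟨
    []                           ∎)
    where open SetoidReasoning ∼-setoid

  *ₚ-congʳ : ∀ {p p'} r → p ∼ p' → (p *ₚ r) ∼ (p' *ₚ r)
  *ₚ-congʳ {[]} {p'} r e = *ₚ-zeroˡ r e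
  *ₚ-congʳ {a ∷ p} {[]} r e = ∼-sym (*ₚ-zeroˡ r (∼-sym e))
  *ₚ-congʳ {a ∷ p} {b ∷ p'} r e =
    +ₚ-cong (scale-cong (∷-injectiveˡ e) ∼-refl) (∷-cong refl (*ₚ-congʳ r (∷-injectiveʳ e)))

  *ₚ-congˡ : ∀ p {r r'} → r ∼ r' → (p *ₚ r) ∼ (p *ₚ r')
  *ₚ-congˡ [] e = ∼-refl
  *ₚ-congˡ (a ∷ p) e = +ₚ-cong (scale-cong refl e) (∷-cong refl (*ₚ-congˡ p e))

  *ₚ-cong : ∀ {p p' r r'} → p ∼ p' → r ∼ r' → (p *ₚ r) ∼ (p' *ₚ r')
  *ₚ-cong {p' = p'} {r = r} e f = ∼-trans (*ₚ-congʳ r e) (*ₚ-congˡ p' f)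

  *ₚ-zeroʳ : ∀ p → (p *ₚ []) ∼ []
  *ₚ-zeroʳ [] = ∼-refl
  *ₚ-zeroʳ (a ∷ p) = ∼-sym ([]∼∷⁺ refl (∼-sym (*ₚ-zeroʳ p)))

  0∷-*ₚ : ∀ s r → ((0# ∷ s) *ₚ r) ∼ (0# ∷ (s *ₚ r))
  0∷-*ₚ s r = +ₚ-cong (scale-zero r) ∼-refl

  *ₚ-∷ʳ : ∀ p c r → (p *ₚ (c ∷ r)) ∼ (scale c p +ₚ (0# ∷ (p *ₚ r)))
  *ₚ-∷ʳ [] c r = []∼∷⁺ refl ∼-refl
  *ₚ-∷ʳ (a ∷ p) c r = ∷-cong (cong (_+ 0#) (𝔽.*-comm a c)) (begin
    scale a r +ₚ (p *ₚ (c ∷ r))                  ≈⟨ +ₚ-cong ∼-refl (*ₚ-∷ʳ p c r) ⟩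
    scale a r +ₚ (scale c p +ₚ (0# ∷ (p *ₚ r)))  ≈⟨ +ₚ-assoc (scale a r) _ _ ⟨
    (scale a r +ₚ scale c p) +ₚ (0# ∷ (p *ₚ r))  ≈⟨ +ₚ-cong (+ₚ-comm (scale a r) _) ∼-refl ⟩
    (scale c p +ₚ scale a r) +ₚ (0# ∷ (p *ₚ r))  ≈⟨ +ₚ-assoc (scale c p) _ _ ⟩
    scale c p +ₚ (scale a r +ₚ (0# ∷ (p *ₚ r)))  ∎)
    where open SetoidReasoning ∼-setoid

  *ₚ-comm : ∀ p r → (p *ₚ r) ∼ (r *ₚ p)
  *ₚ-comm [] r = ∼-sym (*ₚ-zeroʳ r)
  *ₚ-comm (a ∷ p) r =
    ∼-trans (+ₚ-cong ∼-refl (∷-cong refl (*ₚ-comm p r))) (∼-sym (*ₚ-∷ʳ r a p))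

  scale-*ₚˡ : ∀ c p r → (scale c p *ₚ r) ∼ scale c (p *ₚ r)
  scale-*ₚˡ c [] r = ∼-refl
  scale-*ₚˡ c (a ∷ p) r = begin
    scale (c * a) r +ₚ (0# ∷ (scale c p *ₚ r))
      ≈⟨ +ₚ-cong (∼-sym (scale-scale c a r)) (∷-cong (sym (𝔽.zeroʳ c)) (scale-*ₚˡ c p r)) ⟩
    scale c (scale a r) +ₚ scale c (0# ∷ (p *ₚ r))
      ≈⟨ scale-distrib-+ₚ c (scale a r) (0# ∷ (p *ₚ r)) ⟨
    scale c (scale a r +ₚ (0# ∷ (p *ₚ r))) ∎
    where open SetoidReasoning ∼-setoid

  *ₚ-distribʳ : ∀ r p s → ((p +ₚ s) *ₚ r) ∼ ((p *ₚ r) +ₚ (s *ₚ r))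
  *ₚ-distribʳ r [] s = ∼-refl
  *ₚ-distribʳ r (a ∷ p) [] = ∼-sym (+ₚ-identityʳ _)
  *ₚ-distribʳ r (a ∷ p) (b ∷ s) = begin
    scale (a + b) r +ₚ (0# ∷ ((p +ₚ s) *ₚ r))
      ≈⟨ +ₚ-cong (scale-distrib-+ a b r) (∷-cong (sym (𝔽.+-identityˡ 0#)) (*ₚ-distribʳ r p s)) ⟩
    (scale a r +ₚ scale b r) +ₚ ((0# ∷ (p *ₚ r)) +ₚ (0# ∷ (s *ₚ r)))
      ≈⟨ ℙ+.interchange (scale a r) (scale b r) (0# ∷ (p *ₚ r)) (0# ∷ (s *ₚ r)) ⟩
    (scale a r +ₚ (0# ∷ (p *ₚ r))) +ₚ (scale b r +ₚ (0# ∷ (s *ₚ r))) ∎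
    where open SetoidReasoning ∼-setoid

  *ₚ-assoc : ∀ p r s → ((p *ₚ r) *ₚ s) ∼ (p *ₚ (r *ₚ s))
  *ₚ-assoc [] r s = ∼-refl
  *ₚ-assoc (a ∷ p) r s = begin
    (scale a r +ₚ (0# ∷ (p *ₚ r))) *ₚ s          ≈⟨ *ₚ-distribʳ s (scale a r) _ ⟩
    (scale a r *ₚ s) +ₚ ((0# ∷ (p *ₚ r)) *ₚ s)   ≈⟨ +ₚ-cong (scale-*ₚˡ a r s) (0∷-*ₚ (p *ₚ r) s) ⟩
    scale a (r *ₚ s) +ₚ (0# ∷ ((p *ₚ r) *ₚ s))   ≈⟨ +ₚ-cong ∼-refl (∷-cong refl (*ₚ-assoc p r s)) ⟩
    scale a (r *ₚ s) +ₚ (0# ∷ (p *ₚ (r *ₚ s)))   ∎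
    where open SetoidReasoning ∼-setoid

  *ₚ-identityˡ : ∀ p → (oneₚ *ₚ p) ∼ p
  *ₚ-identityˡ p = ∼-trans (+ₚ-cong (scale-one p) (∼-sym ([]∼∷⁺ refl ∼-refl))) (+ₚ-identityʳ p)

  polynomialRing : CommutativeRing _ _
  polynomialRing = record
    { isCommutativeRing = record
      { isRing = record
        { +-isAbelianGroup = +ₚ-isAbelianGroup
        ; *-cong = *ₚ-cong
        ; *-assoc = *ₚ-assoc
        ; *-identity = *ₚ-identityˡ , λ p → ∼-trans (*ₚ-comm p oneₚ) (*ₚ-identityˡ p)
        ; distrib = (λ p r s → ∼-trans (*ₚ-comm p _) (∼-trans (*ₚ-distribʳ p r s) (+ₚ-cong (*ₚ-comm r p) (*ₚ-comm s p))))
                  , *ₚ-distribʳ }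
      ; *-comm = *ₚ-comm } }

  module ℙ where
    open CommutativeRing polynomialRing public
    open RingProperties ring public
    open import Algebra.Properties.CommutativeSemiring.Exp commutativeSemiring public

  module ℙ* = CommutativeSemigroupProperties (CommutativeRing.*-commutativeSemigroup polynomialRing)

  ^ₚ-∼-^ : ∀ p n → (p ^ₚ n) ∼ (p ℙ.^ n)
  ^ₚ-∼-^ p zero = ∼-refl
  ^ₚ-∼-^ p (suc n) = *ₚ-congˡ p (^ₚ-∼-^ p n)

  ^ₚ-cong : ∀ k {p p'} → p ∼ p' → (p ^ₚ k) ∼ (p' ^ₚ k)
  ^ₚ-cong k {p} {p'} e = begin
    p ^ₚ k   ≈⟨ ^ₚ-∼-^ p k ⟩
    p ℙ.^ k  ≈⟨ ℙ.^-congˡ k e ⟩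
    p' ℙ.^ k ≈⟨ ^ₚ-∼-^ p' k ⟨
    p' ^ₚ k  ∎
    where open SetoidReasoning ∼-setoid

  ^ₚ-distrib-*ₚ : ∀ p r k → ((p *ₚ r) ^ₚ k) ∼ ((p ^ₚ k) *ₚ (r ^ₚ k))
  ^ₚ-distrib-*ₚ p r k = begin
    (p *ₚ r) ^ₚ k            ≈⟨ ^ₚ-∼-^ (p *ₚ r) k ⟩
    (p *ₚ r) ℙ.^ k           ≈⟨ ℙ.^-distrib-* p r k ⟩
    (p ℙ.^ k) *ₚ (r ℙ.^ k)   ≈⟨ *ₚ-cong (^ₚ-∼-^ p k) (^ₚ-∼-^ r k) ⟨
    (p ^ₚ k) *ₚ (r ^ₚ k)     ∎
    where open SetoidReasoning ∼-setoid

  scale-*ₚʳ : ∀ c p r → (p *ₚ scale c r) ∼ scale c (p *ₚ r)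
  scale-*ₚʳ c p r =
    ∼-trans (*ₚ-comm p (scale c r)) (∼-trans (scale-*ₚˡ c r p) (scale-cong refl (*ₚ-comm r p)))

  shift-*ₚ : ∀ n p r → (shift n p *ₚ r) ∼ shift n (p *ₚ r)
  shift-*ₚ zero p r = ∼-refl
  shift-*ₚ (suc n) p r = ∼-trans (0∷-*ₚ (shift n p) r) (∷-cong refl (shift-*ₚ n p r))

  cons' : Carrier → Pol → Pol
  cons' a [] = if isZ a then [] else a ∷ []
  cons' a (b ∷ r) = a ∷ b ∷ r

  norm-∷ : ∀ a p → norm (a ∷ p) ≡ cons' a (norm p)
  norm-∷ a p with norm p
  ... | [] = refl
  ... | b ∷ r = refl

  coeff-cons' : ∀ i a l → coeff i (cons' a l) ≡ coeff i (a ∷ l)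
  coeff-cons' i a (b ∷ l) = refl
  coeff-cons' i a [] with a ≟ 0#
  coeff-cons' zero a [] | yes a≡0 = sym a≡0
  coeff-cons' (suc i) a [] | yes _ = refl
  ... | no _ = refl

  cons'-zero : ∀ {a} → a ≡ 0# → cons' a [] ≡ []
  cons'-zero {a} a≡0 with a ≟ 0#
  ... | yes _ = refl
  ... | no a≢0 = ⊥-elim (a≢0 a≡0)

  coeff-norm : ∀ i p → coeff i (norm p) ≡ coeff i p
  coeff-norm i [] = refl
  coeff-norm i (a ∷ p) =
    trans (cong (coeff i) (norm-∷ a p)) (trans (coeff-cons' i a (norm p)) (coeff-∷-norm i))
    where
    coeff-∷-norm : ∀ i → coeff i (a ∷ norm p) ≡ coeff i (a ∷ p)
    coeff-∷-norm zero = refl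
    coeff-∷-norm (suc i) = coeff-norm i p

  norm-∼ : ∀ p → norm p ∼ p
  norm-∼ p = mk∼ λ i → coeff-norm i p

  ∼⇒≈ₚ : ∀ {p r} → p ∼ r → p ≈ₚ r
  ∼⇒≈ₚ {[]} {[]} e = refl
  ∼⇒≈ₚ {[]} {b ∷ r} e with []∼∷⁻ e
  ... | b≡0 , []∼r = sym (trans (norm-∷ b r) (trans (cong (cons' b) (sym (∼⇒≈ₚ []∼r))) (cons'-zero b≡0)))
  ∼⇒≈ₚ {a ∷ p} {[]} e with []∼∷⁻ (∼-sym e)
  ... | a≡0 , []∼p = trans (norm-∷ a p) (trans (cong (cons' a) (sym (∼⇒≈ₚ []∼p))) (cons'-zero a≡0))
  ∼⇒≈ₚ {a ∷ p} {b ∷ r} e = begin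
    norm (a ∷ p)      ≡⟨ norm-∷ a p ⟩
    cons' a (norm p)  ≡⟨ cong₂ cons' (∷-injectiveˡ e) (∼⇒≈ₚ (∷-injectiveʳ e)) ⟩
    cons' b (norm r)  ≡⟨ norm-∷ b r ⟨
    norm (b ∷ r)      ∎
    where open ≡-Reasoning

  ≈ₚ⇒∼ : ∀ {p r} → p ≈ₚ r → p ∼ r
  ≈ₚ⇒∼ {p} {r} e = ∼-trans (∼-sym (norm-∼ p)) (∼-trans (≡⇒∼ e) (norm-∼ r))

  -- For nonzero p, len p = deg p + 1; the zero polynomial has len 0.
  len : Pol → ℕ
  len p = length (norm p)

  len-cong : ∀ {p r} → p ∼ r → len p ≡ len r
  len-cong e = cong length (∼⇒≈ₚ e)

  VanishesFrom : ℕ → Pol → Set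
  VanishesFrom n p = ∀ i → n ≤ i → coeff i p ≡ 0#

  vanishesFrom-cong : ∀ {n p r} → p ∼ r → VanishesFrom n p → VanishesFrom n r
  vanishesFrom-cong e v i n≤i = trans (sym (at e i)) (v i n≤i)

  vanishesFrom-mono : ∀ {m n p} → m ≤ n → VanishesFrom m p → VanishesFrom n p
  vanishesFrom-mono m≤n v i n≤i = v i (ℕₚ.≤-trans m≤n n≤i)

  vanishesFrom-length : ∀ l → VanishesFrom (length l) l
  vanishesFrom-length [] i _ = refl
  vanishesFrom-length (a ∷ l) (suc i) (s≤s le) = vanishesFrom-length l i le

  vanishesFrom-len : ∀ p {n} → len p ≡ n → VanishesFrom n p
  vanishesFrom-len p refl = vanishesFrom-cong (norm-∼ p) (vanishesFrom-length (norm p))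

  vanishesFrom-0⇒[]∼ : ∀ p → VanishesFrom 0 p → [] ∼ p
  vanishesFrom-0⇒[]∼ p v = mk∼ λ i → sym (v i z≤n)

  []∼⇒vanishesFrom : ∀ {p} n → [] ∼ p → VanishesFrom n p
  []∼⇒vanishesFrom n e i _ = sym (at e i)

  lastC≡coeff : ∀ l → lastC l ≡ coeff (length l ∸ 1) l
  lastC≡coeff [] = refl
  lastC≡coeff (a ∷ []) = refl
  lastC≡coeff (a ∷ b ∷ r) = lastC≡coeff (b ∷ r)

  lead≡coeff : ∀ p {n} → len p ≡ suc n → lead p ≡ coeff n p
  lead≡coeff p e =
    trans (lastC≡coeff (norm p)) (trans (cong (λ m → coeff (m ∸ 1) (norm p)) e) (coeff-norm _ p))

  norm≡[]⊎lastC≢0 : ∀ p → norm p ≡ [] ⊎ lastC (norm p) ≢ 0#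
  norm≡[]⊎lastC≢0 [] = inj₁ refl
  norm≡[]⊎lastC≢0 (a ∷ p) rewrite norm-∷ a p with norm p | norm≡[]⊎lastC≢0 p
  ... | b ∷ r | inj₂ last≢0 = inj₂ last≢0
  ... | [] | _ with a ≟ 0#
  ... | yes _ = inj₁ refl
  ... | no a≢0 = inj₂ a≢0

  leadingCoeff≢0 : ∀ p {n} → len p ≡ suc n → coeff n p ≢ 0#
  leadingCoeff≢0 p {n} e c≡0 with norm≡[]⊎lastC≢0 p
  ... | inj₁ norm≡[] with () ← trans (sym e) (cong length norm≡[])
  ... | inj₂ last≢0 = last≢0 (trans (lead≡coeff p e) c≡0)

  vanishesFrom⇒len≤ : ∀ {n} p → VanishesFrom n p → len p ≤ n
  vanishesFrom⇒len≤ {n} p v with len p ℕ.≤? n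
  ... | yes le = le
  ... | no nle with len p in eq
  ... | zero = ⊥-elim (nle z≤n)
  ... | suc m = ⊥-elim (leadingCoeff≢0 p eq (v m (ℕₚ.≤-pred (ℕₚ.≰⇒> nle))))

  len<⇒vanishesFrom : ∀ p {n} → len p < suc n → VanishesFrom n p
  len<⇒vanishesFrom p (s≤s le) = vanishesFrom-mono {p = p} le (vanishesFrom-len p refl)

  len≤length : ∀ p → len p ≤ length p
  len≤length p = vanishesFrom⇒len≤ p (vanishesFrom-length p)

  len≡0⇒[]∼ : ∀ p → len p ≡ 0 → [] ∼ p
  len≡0⇒[]∼ p e = vanishesFrom-0⇒[]∼ p (vanishesFrom-len p e)

  []∼⇒len≡0 : ∀ {p} → [] ∼ p → len p ≡ 0
  []∼⇒len≡0 e = sym (len-cong e)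

  nonzero⇒len≡suc : ∀ p → ¬ ([] ∼ p) → Σ ℕ λ n → len p ≡ suc n
  nonzero⇒len≡suc p p≁0 with len p in eq
  ... | zero = ⊥-elim (p≁0 (len≡0⇒[]∼ p eq))
  ... | suc n = n , refl

  *ₚ-vanishesFrom : ∀ a b p r → VanishesFrom a p → VanishesFrom (suc b) r →
                    VanishesFrom (a ℕ.+ b) (p *ₚ r)
  *ₚ-vanishesFrom a b [] r _ _ i _ = refl
  *ₚ-vanishesFrom zero b (c ∷ p) r vp vr =
    []∼⇒vanishesFrom b (*ₚ-zeroˡ r (vanishesFrom-0⇒[]∼ (c ∷ p) vp))
  *ₚ-vanishesFrom (suc a) b (c ∷ p) r vp vr (suc i) (s≤s le) = begin
    coeff (suc i) ((c ∷ p) *ₚ r)                    ≡⟨ coeff-+ₚ (suc i) (scale c r) _ ⟩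
    coeff (suc i) (scale c r) + coeff i (p *ₚ r)    ≡⟨ cong₂ _+_ scale-top tail-top ⟩
    0# + 0#                                         ≡⟨ 𝔽.+-identityˡ 0# ⟩
    0#                                              ∎
    where
    open ≡-Reasoning
    scale-top : coeff (suc i) (scale c r) ≡ 0#
    scale-top = trans (coeff-scale (suc i) c r)
      (trans (cong (c *_) (vr (suc i) (s≤s (ℕₚ.≤-trans (ℕₚ.m≤n+m b a) le)))) (𝔽.zeroʳ c))
    tail-top : coeff i (p *ₚ r) ≡ 0#
    tail-top = *ₚ-vanishesFrom a b p r (λ j le' → vp (suc j) (s≤s le')) vr i le

  coeff-*ₚ-top : ∀ a b p r → VanishesFrom (suc a) p → VanishesFrom (suc b) r →
                 coeff (a ℕ.+ b) (p *ₚ r) ≡ coeff a p * coeff b r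
  coeff-*ₚ-top a b [] r _ _ = sym (𝔽.zeroˡ _)
  coeff-*ₚ-top zero b (c ∷ p) r vp vr = begin
    coeff b ((c ∷ p) *ₚ r)                          ≡⟨ coeff-+ₚ b (scale c r) _ ⟩
    coeff b (scale c r) + coeff b (0# ∷ (p *ₚ r))   ≡⟨ cong₂ _+_ (coeff-scale b c r) (sym (at tail≡0 b)) ⟩
    c * coeff b r + 0#                              ≡⟨ 𝔽.+-identityʳ _ ⟩
    c * coeff b r                                   ∎
    where
    open ≡-Reasoning
    tail≡0 : [] ∼ (0# ∷ (p *ₚ r))
    tail≡0 = []∼∷⁺ refl (*ₚ-zeroˡ r (vanishesFrom-0⇒[]∼ p (λ j _ → vp (suc j) (s≤s z≤n))))
  coeff-*ₚ-top (suc a) b (c ∷ p) r vp vr = begin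
    coeff (suc (a ℕ.+ b)) ((c ∷ p) *ₚ r)                        ≡⟨ coeff-+ₚ (suc (a ℕ.+ b)) (scale c r) _ ⟩
    coeff (suc (a ℕ.+ b)) (scale c r) + coeff (a ℕ.+ b) (p *ₚ r) ≡⟨ cong₂ _+_ scale-top tail-top ⟩
    0# + coeff a p * coeff b r                                  ≡⟨ 𝔽.+-identityˡ _ ⟩
    coeff a p * coeff b r                                       ∎
    where
    open ≡-Reasoning
    scale-top : coeff (suc (a ℕ.+ b)) (scale c r) ≡ 0#
    scale-top = trans (coeff-scale _ c r) (trans (cong (c *_) (vr _ (s≤s (ℕₚ.m≤n+m b a)))) (𝔽.zeroʳ c))
    tail-top : coeff (a ℕ.+ b) (p *ₚ r) ≡ coeff a p * coeff b r
    tail-top = coeff-*ₚ-top a b p r (λ j le → vp (suc j) (s≤s le)) vr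

  len-*ₚ : ∀ p r {a b} → len p ≡ suc a → len r ≡ suc b → len (p *ₚ r) ≡ suc (a ℕ.+ b)
  len-*ₚ p r {a} {b} ep er = ℕₚ.≤-antisym len≤ len≥
    where
    vp = vanishesFrom-len p ep
    vr = vanishesFrom-len r er
    len≤ : len (p *ₚ r) ≤ suc (a ℕ.+ b)
    len≤ = vanishesFrom⇒len≤ (p *ₚ r) (*ₚ-vanishesFrom (suc a) b p r vp vr)
    top≢0 : coeff (a ℕ.+ b) (p *ₚ r) ≢ 0#
    top≢0 top≡0 = *-≢0 (leadingCoeff≢0 p ep) (leadingCoeff≢0 r er)
                      (trans (sym (coeff-*ₚ-top a b p r vp vr)) top≡0)
    len≥ : suc (a ℕ.+ b) ≤ len (p *ₚ r)
    len≥ with suc (a ℕ.+ b) ℕ.≤? len (p *ₚ r)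
    ... | yes le = le
    ... | no nle = ⊥-elim (top≢0 (vanishesFrom-len (p *ₚ r) refl _ (ℕₚ.≤-pred (ℕₚ.≰⇒> nle))))

  *ₚ-zero⇒zero : ∀ p r → [] ∼ (p *ₚ r) → ¬ ([] ∼ r) → [] ∼ p
  *ₚ-zero⇒zero p r pr∼0 r≁0 with len p in ep | nonzero⇒len≡suc r r≁0
  ... | zero | _ = len≡0⇒[]∼ p ep
  ... | suc a | b , er with () ← trans (sym ([]∼⇒len≡0 pr∼0)) (len-*ₚ p r ep er)

  *ₚ-cancelʳ : ∀ p p' r → (p *ₚ r) ∼ (p' *ₚ r) → ¬ ([] ∼ r) → p ∼ p'
  *ₚ-cancelʳ p p' r e r≁0 = ℙ.x∙y⁻¹≈ε⇒x≈y p p' (∼-sym (*ₚ-zero⇒zero (p -ₚ p') r [p-p']r∼0 r≁0))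
    where
    [p-p']r∼0 : [] ∼ ((p -ₚ p') *ₚ r)
    [p-p']r∼0 = ∼-sym (∼-trans (ℙ.[y-z]x≈yx-zx r p p') (∼-trans (+ₚ-cong e ∼-refl) (-ₚ-inverseʳ (p' *ₚ r))))

  record IsQuotRem (M A Q r : Pol) : Set where
    constructor quotRem
    field
      decomposition : A ∼ ((Q *ₚ M) +ₚ r)
      remainder-short : len r < len M
  open IsQuotRem public

  len-norm : ∀ p → len (norm p) ≡ len p
  len-norm p = len-cong (norm-∼ p)

  vanishesFrom-shift : ∀ n {m} p → VanishesFrom m p → VanishesFrom (n ℕ.+ m) (shift n p)
  vanishesFrom-shift zero p v = v
  vanishesFrom-shift (suc n) p v (suc i) (s≤s le) = vanishesFrom-shift n p v i le

  vanishesFrom-+ₚ : ∀ {n} p r → VanishesFrom n p → VanishesFrom n r → VanishesFrom n (p +ₚ r)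
  vanishesFrom-+ₚ p r vp vr i le =
    trans (coeff-+ₚ i p r) (trans (cong₂ _+_ (vp i le) (vr i le)) (𝔽.+-identityˡ 0#))

  vanishesFrom--ₚ : ∀ {n} p → VanishesFrom n p → VanishesFrom n (-ₚ p)
  vanishesFrom--ₚ p vp i le = trans (coeff--ₚ i p) (trans (cong -_ (vp i le)) 𝔽.-0#≈0#)

  vanishesFrom-scale : ∀ {n} c p → VanishesFrom n p → VanishesFrom n (scale c p)
  vanishesFrom-scale c p vp i le = trans (coeff-scale i c p) (trans (cong (c *_) (vp i le)) (𝔽.zeroʳ c))

  vanishesFrom--ₚ-top : ∀ {a} p s → VanishesFrom (suc a) p → VanishesFrom (suc a) s →
                        coeff a p ≡ coeff a s → VanishesFrom a (p -ₚ s)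
  vanishesFrom--ₚ-top {a} p s vp vs top≡ i a≤i with a ℕ.≟ i
  ... | no a≢i = vanishesFrom-+ₚ p (-ₚ s) vp (vanishesFrom--ₚ s vs) i (ℕₚ.≤∧≢⇒< a≤i a≢i)
  ... | yes refl = begin
    coeff a (p -ₚ s)         ≡⟨ coeff-+ₚ a p (-ₚ s) ⟩
    coeff a p + coeff a (-ₚ s) ≡⟨ cong₂ _+_ top≡ (coeff--ₚ a s) ⟩
    coeff a s + - coeff a s  ≡⟨ 𝔽.-‿inverseʳ _ ⟩
    0#                       ∎
    where open ≡-Reasoning

  shift-scale-∼-*ₚ : ∀ d c M → shift d (scale c (norm M)) ∼ (shift d (c ∷ []) *ₚ M)
  shift-scale-∼-*ₚ d c M = ∼-sym (∼-trans (shift-*ₚ d (c ∷ []) M)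
    (shift-cong d (∼-trans (∼-sym (scale-const c M)) (scale-cong refl (∼-sym (norm-∼ M))))))

  leadingTerm-cancels : ∀ A M {a m} → len A ≡ suc a → len M ≡ suc m → m ≤ a →
    let T = shift (a ∸ m) ((lead A * (lead M ⁻¹)) ∷ []) in
    VanishesFrom a (norm A -ₚ (T *ₚ M))
  leadingTerm-cancels A M {a} {m} eA eM m≤a =
    vanishesFrom--ₚ-top (norm A) (T *ₚ M) vA vTM (trans (coeff-norm a A) (sym topTM))
    where
    d = a ∸ m
    c = lead A * (lead M ⁻¹)
    T = shift d (c ∷ [])
    d+m≡a : d ℕ.+ m ≡ a
    d+m≡a = ℕₚ.m∸n+n≡m m≤a
    vA : VanishesFrom (suc a) (norm A)
    vA = vanishesFrom-len (norm A) (trans (len-norm A) eA)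
    vT : VanishesFrom (suc d) T
    vT = subst (λ n → VanishesFrom n T) (ℕₚ.+-comm d 1) (vanishesFrom-shift d (c ∷ []) (vanishesFrom-length (c ∷ [])))
    vM : VanishesFrom (suc m) M
    vM = vanishesFrom-len M eM
    vTM : VanishesFrom (suc a) (T *ₚ M)
    vTM = subst (λ n → VanishesFrom (suc n) (T *ₚ M)) d+m≡a (*ₚ-vanishesFrom (suc d) m T M vT vM)
    lead-M≢0 : lead M ≢ 0#
    lead-M≢0 e = leadingCoeff≢0 M eM (trans (sym (lead≡coeff M eM)) e)
    topTM : coeff a (T *ₚ M) ≡ coeff a A
    topTM = begin
      coeff a (T *ₚ M)                  ≡⟨ cong (λ n → coeff n (T *ₚ M)) d+m≡a ⟨
      coeff (d ℕ.+ m) (T *ₚ M)          ≡⟨ coeff-*ₚ-top d m T M vT vM ⟩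
      coeff d T * coeff m M             ≡⟨ cong₂ _*_ (trans (cong (λ n → coeff n T) (sym (ℕₚ.+-identityʳ d))) (coeff-shift 0 d (c ∷ [])))
                                                     (sym (lead≡coeff M eM)) ⟩
      (lead A * (lead M ⁻¹)) * lead M   ≡⟨ 𝔽.*-assoc _ _ _ ⟩
      lead A * ((lead M ⁻¹) * lead M)   ≡⟨ cong (lead A *_) (⁻¹-inverseˡ _ lead-M≢0) ⟩
      lead A * 1#                       ≡⟨ 𝔽.*-identityʳ _ ⟩
      lead A                            ≡⟨ lead≡coeff A eA ⟩
      coeff a A                         ∎
      where open ≡-Reasoning

  remF-isQuotRem : ∀ M → 0 < len M → ∀ n A → len A ≤ n → Σ Pol λ Q → IsQuotRem M A Q (remF n A M)
  remF-isQuotRem M pos zero A le =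
    [] , quotRem (∼-sym (norm-∼ A)) (subst (_< len M) (sym (trans (len-norm A) (ℕₚ.n≤0⇒n≡0 le))) pos)
  remF-isQuotRem M pos (suc n) A le with len A ℕ.<? len M
  ... | yes lt = [] , quotRem (∼-sym (norm-∼ A)) (subst (_< len M) (sym (len-norm A)) lt)
  ... | no nlt with len A in eA | len M in eM
  ...   | zero | suc m = ⊥-elim (nlt (s≤s z≤n))
  ...   | suc a | suc m = Q' +ₚ T , quotRem A∼ (remainder-short (proj₂ rec))
    where
    c = lead A * (lead M ⁻¹)
    T = shift (a ∸ m) (c ∷ [])
    A' = norm A -ₚ shift (a ∸ m) (scale c (norm M))
    A'∼ : A' ∼ (norm A -ₚ (T *ₚ M))
    A'∼ = +ₚ-cong (∼-refl {norm A}) (-ₚ-cong (shift-scale-∼-*ₚ (a ∸ m) c M))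
    len-A'≤n : len A' ≤ n
    len-A'≤n = ℕₚ.≤-trans
      (vanishesFrom⇒len≤ A' (vanishesFrom-cong (∼-sym A'∼) (leadingTerm-cancels A M eA eM (ℕₚ.≤-pred (ℕₚ.≮⇒≥ nlt)))))
      (ℕₚ.≤-pred le)
    rec = remF-isQuotRem M (subst (0 <_) (sym eM) pos) n A' len-A'≤n
    Q' = proj₁ rec
    A∼ : A ∼ (((Q' +ₚ T) *ₚ M) +ₚ remF n A' M)
    A∼ = begin
      A                                                ≈⟨ norm-∼ A ⟨
      norm A                                           ≈⟨ ℙ.//-rightDividesˡ (T *ₚ M) (norm A) ⟨
      (norm A -ₚ (T *ₚ M)) +ₚ (T *ₚ M)                 ≈⟨ +ₚ-cong (∼-trans (∼-sym A'∼) (decomposition (proj₂ rec))) ∼-refl ⟩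
      ((Q' *ₚ M) +ₚ remF n A' M) +ₚ (T *ₚ M)           ≈⟨ ℙ+.xy∙z≈xz∙y (Q' *ₚ M) _ _ ⟩
      ((Q' *ₚ M) +ₚ (T *ₚ M)) +ₚ remF n A' M           ≈⟨ +ₚ-cong (∼-sym (*ₚ-distribʳ M Q' T)) ∼-refl ⟩
      ((Q' +ₚ T) *ₚ M) +ₚ remF n A' M                  ∎
      where open SetoidReasoning ∼-setoid

  rem-isQuotRem : ∀ M → 0 < len M → ∀ A → Σ Pol λ Q → IsQuotRem M A Q (rem A M)
  rem-isQuotRem M pos A = remF-isQuotRem M pos (length A) A (len≤length A)

  x+y∼z+w⇒x-z∼w-y : ∀ x y z w → (x +ₚ y) ∼ (z +ₚ w) → (x -ₚ z) ∼ (w -ₚ y)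
  x+y∼z+w⇒x-z∼w-y x y z w e = begin
    x -ₚ z                              ≈⟨ ℙ.+-identityʳ (x -ₚ z) ⟨
    (x -ₚ z) +ₚ []                      ≈⟨ +ₚ-cong ∼-refl (-ₚ-inverseʳ y) ⟨
    (x -ₚ z) +ₚ (y -ₚ y)                ≈⟨ ℙ+.interchange x (-ₚ z) y (-ₚ y) ⟩
    (x +ₚ y) +ₚ ((-ₚ z) +ₚ (-ₚ y))      ≈⟨ +ₚ-cong e ∼-refl ⟩
    (z +ₚ w) +ₚ ((-ₚ z) +ₚ (-ₚ y))      ≈⟨ ℙ+.interchange z w (-ₚ z) (-ₚ y) ⟩
    (z -ₚ z) +ₚ (w -ₚ y)                ≈⟨ +ₚ-cong (-ₚ-inverseʳ z) ∼-refl ⟩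
    w -ₚ y                              ∎
    where open SetoidReasoning ∼-setoid

  short-multiple⇒[]∼ : ∀ D M s → (D *ₚ M) ∼ s → len s < len M → [] ∼ s
  short-multiple⇒[]∼ D M s DM∼s s<M with len D in eD | len M in eM
  ... | zero | _ = ∼-trans (*ₚ-zeroˡ M (len≡0⇒[]∼ D eD)) DM∼s
  ... | suc a | suc b = ⊥-elim (ℕₚ.<-irrefl refl (ℕₚ.≤-trans (s≤s (ℕₚ.m≤n+m b a)) len-DM≤b))
    where
    len-DM≤b : suc (a ℕ.+ b) ≤ b
    len-DM≤b = subst (_≤ b) (len-*ₚ D M eD eM) (subst (_≤ b) (sym (len-cong DM∼s)) (ℕₚ.≤-pred s<M))

  quotRem-unique : ∀ M {A Q₁ Q₂ r₁ r₂} → IsQuotRem M A Q₁ r₁ → IsQuotRem M A Q₂ r₂ → r₁ ∼ r₂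
  quotRem-unique M {A} {Q₁} {Q₂} {r₁} {r₂} (quotRem e₁ r₁<M) (quotRem e₂ r₂<M) =
    ∼-sym (ℙ.x∙y⁻¹≈ε⇒x≈y r₂ r₁ (∼-sym (short-multiple⇒[]∼ (Q₁ -ₚ Q₂) M (r₂ -ₚ r₁) DM∼ r₂-r₁<M)))
    where
    DM∼ : ((Q₁ -ₚ Q₂) *ₚ M) ∼ (r₂ -ₚ r₁)
    DM∼ = ∼-trans (ℙ.[y-z]x≈yx-zx M Q₁ Q₂) (x+y∼z+w⇒x-z∼w-y (Q₁ *ₚ M) r₁ (Q₂ *ₚ M) r₂ (∼-trans (∼-sym e₁) e₂))
    r₂-r₁<M : len (r₂ -ₚ r₁) < len M
    r₂-r₁<M with len M
    ... | suc b = s≤s (vanishesFrom⇒len≤ (r₂ -ₚ r₁)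
      (vanishesFrom-+ₚ r₂ (-ₚ r₁) (len<⇒vanishesFrom r₂ r₂<M) (vanishesFrom--ₚ r₁ (len<⇒vanishesFrom r₁ r₁<M))))

  rem-unique : ∀ M A Q r → IsQuotRem M A Q r → rem A M ∼ r
  rem-unique M A Q r qr =
    quotRem-unique M (proj₂ (rem-isQuotRem M (ℕₚ.≤-trans (s≤s z≤n) (remainder-short qr)) A)) qr

  rem-cong : ∀ M {A A'} → 0 < len M → A ∼ A' → rem A M ∼ rem A' M
  rem-cong M {A} {A'} pos e with rem-isQuotRem M pos A
  ... | Q , quotRem dec short = ∼-sym (rem-unique M A' Q (rem A M) (quotRem (∼-trans (∼-sym e) dec) short))

  rem-congᴹ : ∀ {M M'} A → 0 < len M → M ∼ M' → rem A M ∼ rem A M'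
  rem-congᴹ {M} {M'} A pos e with rem-isQuotRem M pos A
  ... | Q , quotRem dec short = ∼-sym (rem-unique M' A Q (rem A M)
    (quotRem (∼-trans dec (+ₚ-cong (*ₚ-congˡ Q e) ∼-refl)) (subst (len (rem A M) <_) (len-cong e) short)))

  len<-+ₚ : ∀ {n} p r → len p < n → len r < n → len (p +ₚ r) < n
  len<-+ₚ {suc n} p r p<n r<n =
    s≤s (vanishesFrom⇒len≤ (p +ₚ r) (vanishesFrom-+ₚ p r (len<⇒vanishesFrom p p<n) (len<⇒vanishesFrom r r<n)))

  len<-scale : ∀ {n} c p → len p < n → len (scale c p) < n
  len<-scale {suc n} c p p<n = s≤s (vanishesFrom⇒len≤ (scale c p) (vanishesFrom-scale c p (len<⇒vanishesFrom p p<n)))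

  rem-+ₚ : ∀ M A B → 0 < len M → rem (A +ₚ B) M ∼ (rem A M +ₚ rem B M)
  rem-+ₚ M A B pos with rem-isQuotRem M pos A | rem-isQuotRem M pos B
  ... | QA , quotRem decA shortA | QB , quotRem decB shortB =
    rem-unique M (A +ₚ B) (QA +ₚ QB) _ (quotRem dec (len<-+ₚ (rem A M) (rem B M) shortA shortB))
    where
    dec : (A +ₚ B) ∼ (((QA +ₚ QB) *ₚ M) +ₚ (rem A M +ₚ rem B M))
    dec = ∼-trans (+ₚ-cong decA decB)
      (∼-trans (ℙ+.interchange (QA *ₚ M) (rem A M) (QB *ₚ M) (rem B M)) (+ₚ-cong (∼-sym (*ₚ-distribʳ M QA QB)) ∼-refl))

  rem-scale : ∀ M c A → 0 < len M → rem (scale c A) M ∼ scale c (rem A M)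
  rem-scale M c A pos with rem-isQuotRem M pos A
  ... | QA , quotRem decA shortA =
    rem-unique M (scale c A) (scale c QA) _ (quotRem dec (len<-scale c (rem A M) shortA))
    where
    dec : scale c A ∼ ((scale c QA *ₚ M) +ₚ scale c (rem A M))
    dec = ∼-trans (scale-cong refl decA)
      (∼-trans (scale-distrib-+ₚ c (QA *ₚ M) (rem A M)) (+ₚ-cong (∼-sym (scale-*ₚˡ c QA M)) ∼-refl))

  rem-short : ∀ M A → len A < len M → rem A M ∼ A
  rem-short M A A<M = rem-unique M A [] A (quotRem ∼-refl A<M)

  rem-multiple : ∀ M Q → 0 < len M → rem (Q *ₚ M) M ∼ []
  rem-multiple M Q pos = rem-unique M (Q *ₚ M) Q [] (quotRem (∼-sym (+ₚ-identityʳ _)) pos)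

  t-deg≡0 : ∀ M A → deg M ≡ 0 → t M A ≡ 0#
  t-deg≡0 M A e with deg M
  ... | zero = refl

  t-rem : ∀ M A {m} → deg M ≡ suc m → t M A ≡ coeff m (rem A M)
  t-rem M A e with deg M
  ... | suc k = cong (λ k → coeff k (rem A M)) (ℕₚ.suc-injective e)

  deg≡suc⇒len : ∀ M {m} → deg M ≡ suc m → len M ≡ suc (suc m)
  deg≡suc⇒len M e with len M
  ... | suc (suc k) = cong suc e

  deg≡suc⇒0<len : ∀ M {m} → deg M ≡ suc m → 0 < len M
  deg≡suc⇒0<len M e = subst (0 <_) (sym (deg≡suc⇒len M e)) (s≤s z≤n)

  deg-cases : ∀ M → (deg M ≡ 0) ⊎ (Σ ℕ λ m → deg M ≡ suc m)
  deg-cases M with deg M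
  ... | zero = inj₁ refl
  ... | suc m = inj₂ (m , refl)

  t-cong : ∀ M {A A'} → A ∼ A' → t M A ≡ t M A'
  t-cong M {A} {A'} e with deg-cases M
  ... | inj₁ d = trans (t-deg≡0 M A d) (sym (t-deg≡0 M A' d))
  ... | inj₂ (m , d) =
    trans (t-rem M A d) (trans (at (rem-cong M (deg≡suc⇒0<len M d) e) m) (sym (t-rem M A' d)))

  t-congᴹ : ∀ {M M'} A → M ∼ M' → t M A ≡ t M' A
  t-congᴹ {M} {M'} A e with deg-cases M
  ... | inj₁ d = trans (t-deg≡0 M A d) (sym (t-deg≡0 M' A d'))
    where d' = trans (cong (_∸ 1) (sym (len-cong e))) d
  ... | inj₂ (m , d) =
    trans (t-rem M A d) (trans (at (rem-congᴹ A (deg≡suc⇒0<len M d) e) m) (sym (t-rem M' A d')))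
    where d' = trans (cong (_∸ 1) (sym (len-cong e))) d

  t-+ₚ : ∀ M A B → t M (A +ₚ B) ≡ t M A + t M B
  t-+ₚ M A B with deg-cases M
  ... | inj₁ d = trans (t-deg≡0 M _ d) (sym (trans (cong₂ _+_ (t-deg≡0 M A d) (t-deg≡0 M B d)) (𝔽.+-identityˡ 0#)))
  ... | inj₂ (m , d) = begin
    t M (A +ₚ B)                       ≡⟨ t-rem M (A +ₚ B) d ⟩
    coeff m (rem (A +ₚ B) M)           ≡⟨ at (rem-+ₚ M A B (deg≡suc⇒0<len M d)) m ⟩
    coeff m (rem A M +ₚ rem B M)       ≡⟨ coeff-+ₚ m (rem A M) (rem B M) ⟩
    coeff m (rem A M) + coeff m (rem B M) ≡⟨ cong₂ _+_ (t-rem M A d) (t-rem M B d) ⟨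
    t M A + t M B                      ∎
    where open ≡-Reasoning

  t-scale : ∀ M c A → t M (scale c A) ≡ c * t M A
  t-scale M c A with deg-cases M
  ... | inj₁ d = trans (t-deg≡0 M _ d) (sym (trans (cong (c *_) (t-deg≡0 M A d)) (𝔽.zeroʳ c)))
  ... | inj₂ (m , d) = begin
    t M (scale c A)                    ≡⟨ t-rem M (scale c A) d ⟩
    coeff m (rem (scale c A) M)        ≡⟨ at (rem-scale M c A (deg≡suc⇒0<len M d)) m ⟩
    coeff m (scale c (rem A M))        ≡⟨ coeff-scale m c (rem A M) ⟩
    c * coeff m (rem A M)              ≡⟨ cong (c *_) (t-rem M A d) ⟨
    c * t M A                          ∎
    where open ≡-Reasoning

  t-multiple : ∀ M Q → t M (Q *ₚ M) ≡ 0#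
  t-multiple M Q with deg-cases M
  ... | inj₁ d = t-deg≡0 M _ d
  ... | inj₂ (m , d) = trans (t-rem M _ d) (at (rem-multiple M Q (deg≡suc⇒0<len M d)) m)

  t-short : ∀ M A {m} → deg M ≡ suc m → len A < len M → t M A ≡ coeff m A
  t-short M A d A<M = trans (t-rem M A d) (at (rem-short M A A<M) _)

  lead-cong : ∀ {p r} → p ∼ r → lead p ≡ lead r
  lead-cong e = cong lastC (∼⇒≈ₚ e)

  lead-[]∼ : ∀ {p} → [] ∼ p → lead p ≡ 0#
  lead-[]∼ e = sym (lead-cong e)

  lead-*ₚ : ∀ p r → lead (p *ₚ r) ≡ lead p * lead r
  lead-*ₚ p r with len p in ep | len r in er
  ... | zero | _ = trans (lead-[]∼ (*ₚ-zeroˡ r p∼0)) (sym (trans (cong (_* lead r) (lead-[]∼ p∼0)) (𝔽.zeroˡ _)))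
    where p∼0 = len≡0⇒[]∼ p ep
  ... | suc a | zero = trans (lead-[]∼ (∼-trans (∼-sym (*ₚ-zeroʳ p)) (*ₚ-congˡ p r∼0)))
                             (sym (trans (cong (lead p *_) (lead-[]∼ r∼0)) (𝔽.zeroʳ _)))
    where r∼0 = len≡0⇒[]∼ r er
  ... | suc a | suc b = begin
    lead (p *ₚ r)             ≡⟨ lead≡coeff (p *ₚ r) (len-*ₚ p r ep er) ⟩
    coeff (a ℕ.+ b) (p *ₚ r)  ≡⟨ coeff-*ₚ-top a b p r (vanishesFrom-len p ep) (vanishesFrom-len r er) ⟩
    coeff a p * coeff b r     ≡⟨ cong₂ _*_ (lead≡coeff p ep) (lead≡coeff r er) ⟨
    lead p * lead r           ∎
    where open ≡-Reasoning

  lead-const : ∀ c → lead (c ∷ []) ≡ c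
  lead-const c with c ≟ 0#
  ... | yes c≡0 = sym c≡0
  ... | no _ = refl

  lead-scale : ∀ c p → lead (scale c p) ≡ c * lead p
  lead-scale c p = trans (lead-cong (scale-const c p)) (trans (lead-*ₚ (c ∷ []) p) (cong (_* lead p) (lead-const c)))

  monic⇒nonzero : ∀ {p} → Monic p → ¬ ([] ∼ p)
  monic⇒nonzero m e = 0≢1 (trans (sym (lead-[]∼ e)) m)

  nonzero⇒lead≢0 : ∀ {p} → ¬ ([] ∼ p) → lead p ≢ 0#
  nonzero⇒lead≢0 {p} p≁0 with nonzero⇒len≡suc p p≁0
  ... | a , e = λ lead≡0 → leadingCoeff≢0 p e (trans (sym (lead≡coeff p e)) lead≡0)

  monic⇒len≡suc : ∀ p → Monic p → Σ ℕ λ a → len p ≡ suc a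
  monic⇒len≡suc p m = nonzero⇒len≡suc p (monic⇒nonzero m)

  monic-*ₚ : ∀ M N → Monic M → Monic N → Monic (M *ₚ N)
  monic-*ₚ M N mM mN = trans (lead-*ₚ M N) (trans (cong₂ _*_ mM mN) (𝔽.*-identityˡ 1#))

  monic-oneₚ : Monic oneₚ
  monic-oneₚ = lead-const 1#

  monic-^ₚ : ∀ D k → Monic D → Monic (D ^ₚ k)
  monic-^ₚ D zero m = monic-oneₚ
  monic-^ₚ D (suc k) m = monic-*ₚ D (D ^ₚ k) m (monic-^ₚ D k m)

  monic-deg≡0⇒∼oneₚ : ∀ p → Monic p → deg p ≡ 0 → p ∼ oneₚ
  monic-deg≡0⇒∼oneₚ p m d with monic⇒len≡suc p m
  ... | a , e = mk∼ coeff≡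
    where
    len≡1 : len p ≡ 1
    len≡1 = trans e (cong suc (trans (sym (cong (_∸ 1) e)) d))
    coeff≡ : ∀ i → coeff i p ≡ coeff i oneₚ
    coeff≡ zero = trans (sym (lead≡coeff p len≡1)) m
    coeff≡ (suc i) = vanishesFrom-len p len≡1 (suc i) (s≤s z≤n)

  t-*ₚ-monic : ∀ M N X → Monic M → Monic N → t (M *ₚ N) (X *ₚ N) ≡ t M X
  t-*ₚ-monic M N X mM mN with monic⇒len≡suc M mM | monic⇒len≡suc N mN
  ... | a , eM | b , eN with rem-isQuotRem M (subst (0 <_) (sym eM) (s≤s z≤n)) X
  ... | Q , quotRem decX shortX = go a refl
    where
    r = rem X M
    eMN : len (M *ₚ N) ≡ suc (a ℕ.+ b)
    eMN = len-*ₚ M N eM eN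
    vr : VanishesFrom a r
    vr = len<⇒vanishesFrom r (subst (len r <_) eM shortX)
    qrXN : IsQuotRem (M *ₚ N) (X *ₚ N) Q (r *ₚ N)
    qrXN = quotRem (∼-trans (*ₚ-congʳ N decX) (∼-trans (*ₚ-distribʳ N (Q *ₚ M) r) (+ₚ-cong (*ₚ-assoc Q M N) ∼-refl)))
                   (subst (len (r *ₚ N) <_) (sym eMN) (s≤s (vanishesFrom⇒len≤ (r *ₚ N) (*ₚ-vanishesFrom a b r N vr (vanishesFrom-len N eN)))))
    go : ∀ a' → a' ≡ a → t (M *ₚ N) (X *ₚ N) ≡ t M X
    go zero refl = begin
      t (M *ₚ N) (X *ₚ N)                  ≡⟨ t-cong (M *ₚ N) (decomposition qrXN) ⟩
      t (M *ₚ N) ((Q *ₚ (M *ₚ N)) +ₚ (r *ₚ N)) ≡⟨ t-cong (M *ₚ N) (+ₚ-cong ∼-refl (∼-sym (*ₚ-zeroˡ N (vanishesFrom-0⇒[]∼ r vr)))) ⟩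
      t (M *ₚ N) ((Q *ₚ (M *ₚ N)) +ₚ [])   ≡⟨ t-cong (M *ₚ N) (+ₚ-identityʳ _) ⟩
      t (M *ₚ N) (Q *ₚ (M *ₚ N))           ≡⟨ t-multiple (M *ₚ N) Q ⟩
      0#                                   ≡⟨ t-deg≡0 M X (cong (_∸ 1) eM) ⟨
      t M X                                ∎
      where open ≡-Reasoning
    go (suc a') refl = begin
      t (M *ₚ N) (X *ₚ N)                  ≡⟨ t-rem (M *ₚ N) (X *ₚ N) (cong (_∸ 1) eMN) ⟩
      coeff (a' ℕ.+ b) (rem (X *ₚ N) (M *ₚ N)) ≡⟨ at (rem-unique (M *ₚ N) (X *ₚ N) Q (r *ₚ N) qrXN) (a' ℕ.+ b) ⟩
      coeff (a' ℕ.+ b) (r *ₚ N)            ≡⟨ coeff-*ₚ-top a' b r N vr (vanishesFrom-len N eN) ⟩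
      coeff a' r * coeff b N               ≡⟨ cong (coeff a' r *_) (trans (sym (lead≡coeff N eN)) mN) ⟩
      coeff a' r * 1#                      ≡⟨ 𝔽.*-identityʳ _ ⟩
      coeff a' r                           ≡⟨ t-rem M X (cong (_∸ 1) eM) ⟨
      t M X                                ∎
      where open ≡-Reasoning

  t--ₚ : ∀ M A → t M (-ₚ A) ≡ - t M A
  t--ₚ M A = trans (t-cong M (-ₚ≈scale-1 A)) (trans (t-scale M (- 1#) A) (𝔽.-1*x≈-x _))

  t-−ₚ : ∀ M A B → t M (A -ₚ B) ≡ t M A + - t M B
  t-−ₚ M A B = trans (t-+ₚ M A (-ₚ B)) (cong (t M A +_) (t--ₚ M B))

  t-multiple-+ₚ : ∀ M X Y → t M ((X *ₚ M) +ₚ Y) ≡ t M Y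
  t-multiple-+ₚ M X Y = trans (t-+ₚ M _ Y) (trans (cong (_+ t M Y) (t-multiple M X)) (𝔽.+-identityˡ _))

  len-oneₚ : len oneₚ ≡ 1
  len-oneₚ with 1# ≟ 0#
  ... | yes 1≡0 = ⊥-elim (0≢1 (sym 1≡0))
  ... | no _ = refl

  len-^ₚ : ∀ H {h} → len H ≡ suc h → ∀ k → len (H ^ₚ k) ≡ suc (k ℕ.* h)
  len-^ₚ H e zero = len-oneₚ
  len-^ₚ H e (suc k) = len-*ₚ H (H ^ₚ k) e (len-^ₚ H e k)

  ¬IsZero⇒len≡suc : ∀ H → ¬ IsZero H → Σ ℕ λ h → len H ≡ suc h
  ¬IsZero⇒len≡suc H H≉0 with norm H
  ... | [] = ⊥-elim (H≉0 refl)
  ... | a ∷ l = length l , refl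

  ∣^ₚ∣ : ∀ H k → ¬ IsZero H → ∣ H ^ₚ k ∣ₚ ≡ ∣ H ∣ₚ ℕ.^ k
  ∣^ₚ∣ H k H≉0 with ¬IsZero⇒len≡suc H H≉0
  ... | h , e = begin
    q ℕ.^ deg (H ^ₚ k)     ≡⟨ cong (λ n → q ℕ.^ (n ∸ 1)) (len-^ₚ H e k) ⟩
    q ℕ.^ (k ℕ.* h)        ≡⟨ cong (q ℕ.^_) (ℕₚ.*-comm k h) ⟩
    q ℕ.^ (h ℕ.* k)        ≡⟨ ℕₚ.^-*-assoc q h k ⟨
    (q ℕ.^ h) ℕ.^ k        ≡⟨ cong (λ n → (q ℕ.^ (n ∸ 1)) ℕ.^ k) e ⟨
    ∣ H ∣ₚ ℕ.^ k           ∎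
    where open ≡-Reasoning

  ∼-sameLength⇒≡ : ∀ p r → length p ≡ length r → p ∼ r → p ≡ r
  ∼-sameLength⇒≡ [] [] _ _ = refl
  ∼-sameLength⇒≡ (a ∷ p) (b ∷ r) e p∼r =
    cong₂ _∷_ (∷-injectiveˡ p∼r) (∼-sameLength⇒≡ p r (ℕₚ.suc-injective e) (∷-injectiveʳ p∼r))

  record IsLinear (φ : Pol → Carrier) : Set where
    field
      resp-∼ : ∀ {A B} → A ∼ B → φ A ≡ φ B
      homo-+ₚ : ∀ A B → φ (A +ₚ B) ≡ φ A + φ B
      homo-scale : ∀ c A → φ (scale c A) ≡ c * φ A
  open IsLinear public

  x^ : ℕ → Pol
  x^ j = shift j oneₚ

  isLinear-0∷ : ∀ {φ} → IsLinear φ → IsLinear (λ w → φ (0# ∷ w))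
  isLinear-0∷ L = record
    { resp-∼ = λ e → resp-∼ L (∷-cong refl e)
    ; homo-+ₚ = λ A B → trans (resp-∼ L (∷-cong (sym (𝔽.+-identityˡ 0#)) ∼-refl)) (homo-+ₚ L _ _)
    ; homo-scale = λ c A → trans (resp-∼ L (∷-cong (sym (𝔽.zeroʳ c)) ∼-refl)) (homo-scale L c _) }

  isLinear-[] : ∀ {φ} → IsLinear φ → φ [] ≡ 0#
  isLinear-[] L = trans (homo-scale L 0# []) (𝔽.zeroˡ _)

  isLinear-∷ : ∀ {φ} → IsLinear φ → ∀ a w → φ (a ∷ w) ≡ a * φ oneₚ + φ (0# ∷ w)
  isLinear-∷ L a w = trans (resp-∼ L a∷w∼) (trans (homo-+ₚ L _ _) (cong (_+ _) (homo-scale L a oneₚ)))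
    where
    a∷w∼ : (a ∷ w) ∼ (scale a oneₚ +ₚ (0# ∷ w))
    a∷w∼ = ∷-cong (sym (trans (cong (_+ 0#) (𝔽.*-identityʳ a)) (𝔽.+-identityʳ a))) ∼-refl

  isLinear-−  : ∀ {φ ψ} → IsLinear φ → IsLinear ψ → IsLinear (λ A → φ A + - ψ A)
  isLinear-− {φ} {ψ} L K = record
    { resp-∼ = λ e → cong₂ (λ x y → x + - y) (resp-∼ L e) (resp-∼ K e)
    ; homo-+ₚ = λ A B → trans (cong₂ (λ x y → x + - y) (homo-+ₚ L A B) (homo-+ₚ K A B))
                          (trans (cong (_ +_) (sym (𝔽.-‿+-comm _ _))) (𝔽+.interchange _ _ _ _))
    ; homo-scale = λ c A → trans (cong₂ (λ x y → x + - y) (homo-scale L c A) (homo-scale K c A))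
                          (trans (cong (_ +_) (𝔽.-‿distribʳ-* c _)) (sym (𝔽.distribˡ c _ _))) }

  isLinear-vanishes : ∀ {φ} → IsLinear φ → ∀ N p → VanishesFrom N p →
                      (∀ j → j < N → φ (x^ j) ≡ 0#) → φ p ≡ 0#
  isLinear-vanishes L N [] v φx^≡0 = isLinear-[] L
  isLinear-vanishes L zero (a ∷ w) v φx^≡0 =
    trans (resp-∼ L (∼-sym (vanishesFrom-0⇒[]∼ (a ∷ w) v))) (isLinear-[] L)
  isLinear-vanishes {φ} L (suc N) (a ∷ w) v φx^≡0 = begin
    φ (a ∷ w)                 ≡⟨ isLinear-∷ L a w ⟩
    a * φ oneₚ + φ (0# ∷ w)   ≡⟨ cong₂ _+_ (trans (cong (a *_) (φx^≡0 0 (s≤s z≤n))) (𝔽.zeroʳ a)) tail≡0 ⟩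
    0# + 0#                   ≡⟨ 𝔽.+-identityˡ 0# ⟩
    0#                        ∎
    where
    open ≡-Reasoning
    tail≡0 : φ (0# ∷ w) ≡ 0#
    tail≡0 = isLinear-vanishes (isLinear-0∷ L) N w (λ i le → v (suc i) (s≤s le)) (λ j lt → φx^≡0 (suc j) (s≤s lt))

  t-isLinear : ∀ M R → IsLinear (λ A → t M (A *ₚ R))
  t-isLinear M R = record
    { resp-∼ = λ e → t-cong M (*ₚ-congʳ R e)
    ; homo-+ₚ = λ A B → trans (t-cong M (*ₚ-distribʳ R A B)) (t-+ₚ M _ _)
    ; homo-scale = λ c A → trans (t-cong M (scale-*ₚˡ c A R)) (t-scale M c _) }

  infix 4 _∣∼_
  _∣∼_ : Pol → Pol → Set
  D ∣∼ X = Σ Pol λ Q → (Q *ₚ D) ∼ X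

  t-rem-divisor : ∀ M R H A → 0 < len H → M ∣∼ H → t M (A *ₚ R) ≡ t M (rem A H *ₚ R)
  t-rem-divisor M R H A pos (P , PM∼H) with rem-isQuotRem H pos A
  ... | Q , quotRem decA _ = trans (t-cong M AR∼) (t-multiple-+ₚ M ((Q *ₚ P) *ₚ R) _)
    where
    AR∼ : (A *ₚ R) ∼ ((((Q *ₚ P) *ₚ R) *ₚ M) +ₚ (rem A H *ₚ R))
    AR∼ = begin
      A *ₚ R                                          ≈⟨ *ₚ-congʳ R decA ⟩
      ((Q *ₚ H) +ₚ rem A H) *ₚ R                      ≈⟨ *ₚ-distribʳ R (Q *ₚ H) (rem A H) ⟩
      ((Q *ₚ H) *ₚ R) +ₚ (rem A H *ₚ R)               ≈⟨ +ₚ-cong (*ₚ-congʳ R (*ₚ-congˡ Q PM∼H)) ∼-refl ⟨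
      ((Q *ₚ (P *ₚ M)) *ₚ R) +ₚ (rem A H *ₚ R)        ≈⟨ +ₚ-cong QPMR∼ ∼-refl ⟩
      (((Q *ₚ P) *ₚ R) *ₚ M) +ₚ (rem A H *ₚ R)        ∎
      where
      open SetoidReasoning ∼-setoid
      QPMR∼ : ((Q *ₚ (P *ₚ M)) *ₚ R) ∼ (((Q *ₚ P) *ₚ R) *ₚ M)
      QPMR∼ = ∼-trans (*ₚ-congʳ R (∼-sym (*ₚ-assoc Q P M))) (ℙ*.xy∙z≈xz∙y (Q *ₚ P) M R)

  -- Testing against A = x^s picks out a single coefficient of P.
  t-nondegenerate : ∀ M P {n} → len M ≡ suc n → VanishesFrom n P → (∀ A → t M (A *ₚ P) ≡ 0#) → [] ∼ P
  t-nondegenerate M P {n} eM vP tAP≡0 with len P in eP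
  ... | zero = len≡0⇒[]∼ P eP
  ... | suc p = ⊥-elim (leadingCoeff≢0 P eP (trans (sym t≡coeff) (tAP≡0 (x^ s))))
    where
    p<n : p < n
    p<n = subst (_≤ n) eP (vanishesFrom⇒len≤ P vP)
    s = n ∸ suc p
    s+suc-p≡n : s ℕ.+ suc p ≡ n
    s+suc-p≡n = ℕₚ.m∸n+n≡m p<n
    n≡ : n ≡ suc (s ℕ.+ p)
    n≡ = trans (sym s+suc-p≡n) (ℕₚ.+-suc s p)
    x^sP∼ : (x^ s *ₚ P) ∼ shift s P
    x^sP∼ = ∼-trans (shift-*ₚ s oneₚ P) (shift-cong s (*ₚ-identityˡ P))
    v : VanishesFrom n (x^ s *ₚ P)
    v = vanishesFrom-cong (∼-sym x^sP∼) (subst (λ m → VanishesFrom m (shift s P)) s+suc-p≡n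
          (vanishesFrom-shift s P (vanishesFrom-len P eP)))
    t≡coeff : t M (x^ s *ₚ P) ≡ coeff p P
    t≡coeff = trans (t-short M (x^ s *ₚ P) (trans (cong (_∸ 1) eM) n≡)
                      (subst (len (x^ s *ₚ P) <_) (sym eM) (s≤s (vanishesFrom⇒len≤ (x^ s *ₚ P) v))))
                    (trans (at x^sP∼ (s ℕ.+ p)) (coeff-shift p s P))

  cross-multiply-from-t : ∀ M₁ M₂ R₁ R₂ → Monic M₁ → Monic M₂ →
    VanishesFrom (deg M₁) R₁ → VanishesFrom (deg M₂) R₂ →
    (∀ A → t M₁ (A *ₚ R₁) ≡ t M₂ (A *ₚ R₂)) → (R₁ *ₚ M₂) ∼ (R₂ *ₚ M₁)
  cross-multiply-from-t M₁ M₂ R₁ R₂ m₁ m₂ v₁ v₂ t≡ with monic⇒len≡suc M₁ m₁ | monic⇒len≡suc M₂ m₂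
  ... | a₁ , e₁ | a₂ , e₂ = ℙ.x∙y⁻¹≈ε⇒x≈y _ _ (∼-sym (t-nondegenerate M P (len-*ₚ M₁ M₂ e₁ e₂) vP tAP≡0))
    where
    M = M₁ *ₚ M₂
    P = (R₁ *ₚ M₂) -ₚ (R₂ *ₚ M₁)
    vR₁M₂ : VanishesFrom (a₁ ℕ.+ a₂) (R₁ *ₚ M₂)
    vR₁M₂ = *ₚ-vanishesFrom a₁ a₂ R₁ M₂ (subst (λ n → VanishesFrom n R₁) (cong (_∸ 1) e₁) v₁) (vanishesFrom-len M₂ e₂)
    vR₂M₁ : VanishesFrom (a₁ ℕ.+ a₂) (R₂ *ₚ M₁)
    vR₂M₁ = subst (λ n → VanishesFrom n (R₂ *ₚ M₁)) (ℕₚ.+-comm a₂ a₁)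
      (*ₚ-vanishesFrom a₂ a₁ R₂ M₁ (subst (λ n → VanishesFrom n R₂) (cong (_∸ 1) e₂) v₂) (vanishesFrom-len M₁ e₁))
    vP : VanishesFrom (a₁ ℕ.+ a₂) P
    vP = vanishesFrom-+ₚ (R₁ *ₚ M₂) (-ₚ (R₂ *ₚ M₁)) vR₁M₂ (vanishesFrom--ₚ (R₂ *ₚ M₁) vR₂M₁)
    tAP≡0 : ∀ A → t M (A *ₚ P) ≡ 0#
    tAP≡0 A = begin
      t M (A *ₚ P)                                           ≡⟨ t-cong M (ℙ.x[y-z]≈xy-xz A (R₁ *ₚ M₂) (R₂ *ₚ M₁)) ⟩
      t M ((A *ₚ (R₁ *ₚ M₂)) -ₚ (A *ₚ (R₂ *ₚ M₁)))           ≡⟨ t-−ₚ M _ _ ⟩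
      t M (A *ₚ (R₁ *ₚ M₂)) + - t M (A *ₚ (R₂ *ₚ M₁))        ≡⟨ cong₂ (λ x y → x + - y) t₁ t₂ ⟩
      t M₁ (A *ₚ R₁) + - t M₂ (A *ₚ R₂)                      ≡⟨ cong (_+ - t M₂ (A *ₚ R₂)) (t≡ A) ⟩
      t M₂ (A *ₚ R₂) + - t M₂ (A *ₚ R₂)                      ≡⟨ 𝔽.-‿inverseʳ _ ⟩
      0#                                                     ∎
      where
      open ≡-Reasoning
      t₁ : t M (A *ₚ (R₁ *ₚ M₂)) ≡ t M₁ (A *ₚ R₁)
      t₁ = trans (t-cong M (∼-sym (*ₚ-assoc A R₁ M₂))) (t-*ₚ-monic M₁ M₂ (A *ₚ R₁) m₁ m₂)
      t₂ : t M (A *ₚ (R₂ *ₚ M₁)) ≡ t M₂ (A *ₚ R₂)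
      t₂ = trans (t-congᴹ _ (*ₚ-comm M₁ M₂))
             (trans (t-cong (M₂ *ₚ M₁) (∼-sym (*ₚ-assoc A R₂ M₁))) (t-*ₚ-monic M₂ M₁ (A *ₚ R₂) m₂ m₁))

  record Gcd (A B : Pol) : Set where
    field
      gcd U V : Pol
      bezout : ((U *ₚ A) +ₚ (V *ₚ B)) ∼ gcd
      gcd∣A : gcd ∣∼ A
      gcd∣B : gcd ∣∼ B

  x+y+[z-x]∼y+z : ∀ x y z → ((x +ₚ y) +ₚ (z -ₚ x)) ∼ (y +ₚ z)
  x+y+[z-x]∼y+z x y z = begin
    (x +ₚ y) +ₚ (z -ₚ x)          ≈⟨ +ₚ-cong (+ₚ-comm x y) (+ₚ-comm z (-ₚ x)) ⟩
    (y +ₚ x) +ₚ ((-ₚ x) +ₚ z)     ≈⟨ +ₚ-assoc y x _ ⟩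
    y +ₚ (x +ₚ ((-ₚ x) +ₚ z))     ≈⟨ +ₚ-cong (∼-refl {y}) (ℙ.\\-leftDividesˡ x z) ⟩
    y +ₚ z                        ∎
    where open SetoidReasoning ∼-setoid

  gcd-step : ∀ {A B Q r} → A ∼ ((Q *ₚ B) +ₚ r) → Gcd B r → Gcd A B
  gcd-step {A} {B} {Q} {r} decA g = record
    { gcd = gcd ; U = V ; V = U -ₚ (V *ₚ Q)
    ; bezout = bezout′
    ; gcd∣A = (Q *ₚ X) +ₚ Y , XG∼A
    ; gcd∣B = gcd∣A }
    where
    open Gcd g
    X = proj₁ gcd∣A
    Y = proj₁ gcd∣B
    bezout′ : ((V *ₚ A) +ₚ ((U -ₚ (V *ₚ Q)) *ₚ B)) ∼ gcd
    bezout′ = begin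
      (V *ₚ A) +ₚ ((U -ₚ (V *ₚ Q)) *ₚ B)
        ≈⟨ +ₚ-cong (*ₚ-congˡ V decA) (ℙ.[y-z]x≈yx-zx B U (V *ₚ Q)) ⟩
      (V *ₚ ((Q *ₚ B) +ₚ r)) +ₚ ((U *ₚ B) -ₚ ((V *ₚ Q) *ₚ B))
        ≈⟨ +ₚ-cong (∼-trans (ℙ.distribˡ V (Q *ₚ B) r) (+ₚ-cong (∼-sym (*ₚ-assoc V Q B)) ∼-refl)) ∼-refl ⟩
      (((V *ₚ Q) *ₚ B) +ₚ (V *ₚ r)) +ₚ ((U *ₚ B) -ₚ ((V *ₚ Q) *ₚ B))
        ≈⟨ x+y+[z-x]∼y+z ((V *ₚ Q) *ₚ B) (V *ₚ r) (U *ₚ B) ⟩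
      (V *ₚ r) +ₚ (U *ₚ B)
        ≈⟨ +ₚ-comm (V *ₚ r) (U *ₚ B) ⟩
      (U *ₚ B) +ₚ (V *ₚ r)
        ≈⟨ bezout ⟩
      gcd ∎
      where open SetoidReasoning ∼-setoid
    XG∼A : (((Q *ₚ X) +ₚ Y) *ₚ gcd) ∼ A
    XG∼A = begin
      ((Q *ₚ X) +ₚ Y) *ₚ gcd              ≈⟨ *ₚ-distribʳ gcd (Q *ₚ X) Y ⟩
      ((Q *ₚ X) *ₚ gcd) +ₚ (Y *ₚ gcd)     ≈⟨ +ₚ-cong (∼-trans (*ₚ-assoc Q X gcd) (*ₚ-congˡ Q (proj₂ gcd∣A))) (proj₂ gcd∣B) ⟩
      (Q *ₚ B) +ₚ r                       ≈⟨ decA ⟨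
      A                                   ∎
      where open SetoidReasoning ∼-setoid

  gcdF : ∀ n A B → len B ≤ n → Gcd A B
  gcdF n A B le with len B in eB
  ... | zero = record
    { gcd = A ; U = oneₚ ; V = []
    ; bezout = ∼-trans (+ₚ-identityʳ _) (*ₚ-identityˡ A)
    ; gcd∣A = oneₚ , *ₚ-identityˡ A
    ; gcd∣B = [] , len≡0⇒[]∼ B eB }
  gcdF zero A B () | suc b
  gcdF (suc n) A B le | suc b with rem-isQuotRem B (subst (0 <_) (sym eB) (s≤s z≤n)) A
  ... | Q , quotRem decA shortA =
    gcd-step {Q = Q} decA (gcdF n B (rem A B) (ℕₚ.≤-pred (ℕₚ.≤-trans (subst (len (rem A B) <_) eB shortA) le)))

  scale-*ₚ-scale-⁻¹ : ∀ g X Y → g ≢ 0# → (scale g X *ₚ scale (g ⁻¹) Y) ∼ (X *ₚ Y)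
  scale-*ₚ-scale-⁻¹ g X Y g≢0 = begin
    scale g X *ₚ scale (g ⁻¹) Y         ≈⟨ scale-*ₚˡ g X _ ⟩
    scale g (X *ₚ scale (g ⁻¹) Y)       ≈⟨ scale-cong refl (scale-*ₚʳ (g ⁻¹) X Y) ⟩
    scale g (scale (g ⁻¹) (X *ₚ Y))     ≈⟨ scale-scale g (g ⁻¹) _ ⟩
    scale (g * (g ⁻¹)) (X *ₚ Y)         ≈⟨ scale-cong (⁻¹-inverse g g≢0) ∼-refl ⟩
    scale 1# (X *ₚ Y)                   ≈⟨ scale-one _ ⟩
    X *ₚ Y                              ∎
    where open SetoidReasoning ∼-setoid

  monicGcd : ∀ A B → Monic A → Σ (Gcd A B) λ g → Monic (Gcd.gcd g)
  monicGcd A B mA = g , trans (lead-scale (lead G₀ ⁻¹) G₀) (⁻¹-inverseˡ _ lead≢0)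
    where
    open Gcd (gcdF (len B) A B ℕₚ.≤-refl) renaming (gcd to G₀)
    X = proj₁ gcd∣A
    Y = proj₁ gcd∣B
    lead≢0 : lead G₀ ≢ 0#
    lead≢0 = nonzero⇒lead≢0 λ G₀∼0 →
      monic⇒nonzero mA (∼-trans (∼-sym (*ₚ-zeroʳ X)) (∼-trans (*ₚ-congˡ X G₀∼0) (proj₂ gcd∣A)))
    c = lead G₀ ⁻¹
    g : Gcd A B
    g = record
      { gcd = scale c G₀ ; U = scale c U ; V = scale c V
      ; bezout = ∼-trans (+ₚ-cong (scale-*ₚˡ c U A) (scale-*ₚˡ c V B))
                   (∼-trans (∼-sym (scale-distrib-+ₚ c (U *ₚ A) (V *ₚ B))) (scale-cong refl bezout))
      ; gcd∣A = scale (lead G₀) X , ∼-trans (scale-*ₚ-scale-⁻¹ _ X G₀ lead≢0) (proj₂ gcd∣A)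
      ; gcd∣B = scale (lead G₀) Y , ∼-trans (scale-*ₚ-scale-⁻¹ _ Y G₀ lead≢0) (proj₂ gcd∣B) }

  Coprime : Pol → Pol → Set
  Coprime E F = Σ Pol λ U → Σ Pol λ V → ((U *ₚ E) +ₚ (V *ₚ F)) ∼ oneₚ

  coprime-sym : ∀ {E F} → Coprime E F → Coprime F E
  coprime-sym {E} {F} (U , V , e) = V , U , ∼-trans (+ₚ-comm (V *ₚ F) (U *ₚ E)) e

  coprime-*ₚ : ∀ {E F G} → Coprime E F → Coprime E G → Coprime E (F *ₚ G)
  coprime-*ₚ {E} {F} {G} (U , V , e) (U' , V' , e') = U +ₚ ((V *ₚ F) *ₚ U') , V *ₚ V' , bezout
    where
    W = V *ₚ F
    bezout : (((U +ₚ (W *ₚ U')) *ₚ E) +ₚ ((V *ₚ V') *ₚ (F *ₚ G))) ∼ oneₚ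
    bezout = begin
      ((U +ₚ (W *ₚ U')) *ₚ E) +ₚ ((V *ₚ V') *ₚ (F *ₚ G))
        ≈⟨ +ₚ-cong (*ₚ-distribʳ E U _) (ℙ*.interchange V V' F G) ⟩
      ((U *ₚ E) +ₚ ((W *ₚ U') *ₚ E)) +ₚ (W *ₚ (V' *ₚ G))
        ≈⟨ +ₚ-assoc (U *ₚ E) _ _ ⟩
      (U *ₚ E) +ₚ (((W *ₚ U') *ₚ E) +ₚ (W *ₚ (V' *ₚ G)))
        ≈⟨ +ₚ-cong (∼-refl {U *ₚ E}) (+ₚ-cong (*ₚ-assoc W U' E) ∼-refl) ⟩
      (U *ₚ E) +ₚ ((W *ₚ (U' *ₚ E)) +ₚ (W *ₚ (V' *ₚ G)))
        ≈⟨ +ₚ-cong (∼-refl {U *ₚ E}) (ℙ.distribˡ W _ _) ⟨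
      (U *ₚ E) +ₚ (W *ₚ ((U' *ₚ E) +ₚ (V' *ₚ G)))
        ≈⟨ +ₚ-cong (∼-refl {U *ₚ E}) (∼-trans (*ₚ-congˡ W e') (ℙ.*-identityʳ W)) ⟩
      (U *ₚ E) +ₚ W
        ≈⟨ e ⟩
      oneₚ ∎
      where open SetoidReasoning ∼-setoid

  coprime-^ₚ : ∀ {E F} → Coprime E F → ∀ k → Coprime E (F ^ₚ k)
  coprime-^ₚ {E} c zero = [] , oneₚ , *ₚ-identityˡ oneₚ
  coprime-^ₚ c (suc k) = coprime-*ₚ c (coprime-^ₚ c k)

  coprime-^ₚ-^ₚ : ∀ {E F} → Coprime E F → ∀ k → Coprime (E ^ₚ k) (F ^ₚ k)
  coprime-^ₚ-^ₚ c k = coprime-sym (coprime-^ₚ (coprime-sym (coprime-^ₚ c k)) k)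

  coprime-∣*ₚ⇒∣ : ∀ {A B Y} → Coprime A B → A ∣∼ (B *ₚ Y) → A ∣∼ Y
  coprime-∣*ₚ⇒∣ {A} {B} {Y} (U , V , e) (Z , ZA∼BY) = (U *ₚ Y) +ₚ (V *ₚ Z) , [UY+VZ]A∼Y
    where
    [UY+VZ]A∼Y : (((U *ₚ Y) +ₚ (V *ₚ Z)) *ₚ A) ∼ Y
    [UY+VZ]A∼Y = begin
      ((U *ₚ Y) +ₚ (V *ₚ Z)) *ₚ A           ≈⟨ *ₚ-distribʳ A (U *ₚ Y) (V *ₚ Z) ⟩
      ((U *ₚ Y) *ₚ A) +ₚ ((V *ₚ Z) *ₚ A)    ≈⟨ +ₚ-cong (ℙ*.xy∙z≈xz∙y U Y A) (∼-trans (*ₚ-assoc V Z A) (*ₚ-congˡ V ZA∼BY)) ⟩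
      ((U *ₚ A) *ₚ Y) +ₚ (V *ₚ (B *ₚ Y))    ≈⟨ +ₚ-cong ∼-refl (*ₚ-assoc V B Y) ⟨
      ((U *ₚ A) *ₚ Y) +ₚ ((V *ₚ B) *ₚ Y)    ≈⟨ *ₚ-distribʳ Y (U *ₚ A) (V *ₚ B) ⟨
      ((U *ₚ A) +ₚ (V *ₚ B)) *ₚ Y           ≈⟨ *ₚ-congʳ Y e ⟩
      oneₚ *ₚ Y                             ≈⟨ *ₚ-identityˡ Y ⟩
      Y                                     ∎
      where open SetoidReasoning ∼-setoid

  ∣∼⇒∣ₚ : ∀ {D X} → D ∣∼ X → D ∣ₚ X
  ∣∼⇒∣ₚ (Q , QD∼X) = Q , ∼⇒≈ₚ QD∼X

  ∣ₚ-^ₚ : ∀ {D H} k → D ∣ₚ H → (D ^ₚ k) ∣∼ (H ^ₚ k)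
  ∣ₚ-^ₚ {D} k (Q , QD≈H) = Q ^ₚ k , ∼-trans (∼-sym (^ₚ-distrib-*ₚ Q D k)) (^ₚ-cong k (≈ₚ⇒∼ QD≈H))

  kCoprime-monic-divisor : ∀ k {R M E} → kCoprime k R M → Monic E →
                           (E ^ₚ k) ∣∼ R → (E ^ₚ k) ∣∼ M → E ∼ oneₚ
  kCoprime-monic-divisor k {E = E} kc mE E^k∣R E^k∣M =
    monic-deg≡0⇒∼oneₚ E mE (kc E mE (∣∼⇒∣ₚ E^k∣R) (∣∼⇒∣ₚ E^k∣M))

  monic-cofactor : ∀ {D} G E → Monic D → Monic G → (E *ₚ G) ∼ D → Monic E
  monic-cofactor {D} G E mD mG EG∼D = begin
    lead E             ≡⟨ 𝔽.*-identityʳ _ ⟨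
    lead E * 1#        ≡⟨ cong (lead E *_) mG ⟨
    lead E * lead G    ≡⟨ lead-*ₚ E G ⟨
    lead (E *ₚ G)      ≡⟨ lead-cong EG∼D ⟩
    lead D             ≡⟨ mD ⟩
    1#                 ∎
    where open ≡-Reasoning

  monic-gcd-cofactors : ∀ D₁ D₂ → Monic D₁ → Monic D₂ → Σ Pol λ G → Σ Pol λ E₁ → Σ Pol λ E₂ →
    Monic G × Monic E₁ × Monic E₂ × ((E₁ *ₚ G) ∼ D₁) × ((E₂ *ₚ G) ∼ D₂) × Coprime E₁ E₂
  monic-gcd-cofactors D₁ D₂ m₁ m₂ with monicGcd D₁ D₂ m₁
  ... | g , mG = gcd , E₁ , E₂ , mG , monic-cofactor gcd E₁ m₁ mG E₁G∼D₁ , monic-cofactor gcd E₂ m₂ mG E₂G∼D₂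
                , E₁G∼D₁ , E₂G∼D₂ , U , V , *ₚ-cancelʳ _ oneₚ gcd UE₁+VE₂ (monic⇒nonzero mG)
    where
    open Gcd g
    E₁ = proj₁ gcd∣A
    E₂ = proj₁ gcd∣B
    E₁G∼D₁ = proj₂ gcd∣A
    E₂G∼D₂ = proj₂ gcd∣B
    UE₁+VE₂ : (((U *ₚ E₁) +ₚ (V *ₚ E₂)) *ₚ gcd) ∼ (oneₚ *ₚ gcd)
    UE₁+VE₂ = begin
      ((U *ₚ E₁) +ₚ (V *ₚ E₂)) *ₚ gcd           ≈⟨ *ₚ-distribʳ gcd (U *ₚ E₁) (V *ₚ E₂) ⟩
      ((U *ₚ E₁) *ₚ gcd) +ₚ ((V *ₚ E₂) *ₚ gcd)  ≈⟨ +ₚ-cong (∼-trans (*ₚ-assoc U E₁ gcd) (*ₚ-congˡ U E₁G∼D₁))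
                                                           (∼-trans (*ₚ-assoc V E₂ gcd) (*ₚ-congˡ V E₂G∼D₂)) ⟩
      (U *ₚ D₁) +ₚ (V *ₚ D₂)                    ≈⟨ bezout ⟩
      gcd                                       ≈⟨ *ₚ-identityˡ gcd ⟨
      oneₚ *ₚ gcd                               ∎
      where open SetoidReasoning ∼-setoid

  -- With D = E G for G = gcd(D₁, D₂), the cofactors E₁, E₂ are coprime, so E₁^k ∣ R₁ E₂^k gives E₁^k ∣ R₁;
  -- as also E₁^k ∣ D₁^k, k-coprimality forces E₁ = 1, and likewise E₂ = 1.
  kCoprime-cross⇒∼ : ∀ k D₁ D₂ R₁ R₂ → Monic D₁ → Monic D₂ →
    kCoprime k R₁ (D₁ ^ₚ k) → kCoprime k R₂ (D₂ ^ₚ k) →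
    (R₁ *ₚ (D₂ ^ₚ k)) ∼ (R₂ *ₚ (D₁ ^ₚ k)) → D₁ ∼ D₂
  kCoprime-cross⇒∼ k D₁ D₂ R₁ R₂ m₁ m₂ kc₁ kc₂ cross
    with monic-gcd-cofactors D₁ D₂ m₁ m₂
  ... | G , E₁ , E₂ , mG , mE₁ , mE₂ , E₁G∼D₁ , E₂G∼D₂ , cop =
    ∼-trans (D∼G E₁G∼D₁ E₁∼1) (∼-sym (D∼G E₂G∼D₂ E₂∼1))
    where
    G^k = G ^ₚ k
    D^k∼ : ∀ {E D} → (E *ₚ G) ∼ D → (D ^ₚ k) ∼ ((E ^ₚ k) *ₚ G^k)
    D^k∼ EG∼D = ∼-trans (^ₚ-cong k (∼-sym EG∼D)) (^ₚ-distrib-*ₚ _ G k)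
    E^k∣D^k : ∀ {E D} → (E *ₚ G) ∼ D → (E ^ₚ k) ∣∼ (D ^ₚ k)
    E^k∣D^k EG∼D = G^k , ∼-trans (*ₚ-comm G^k _) (∼-sym (D^k∼ EG∼D))
    cross′ : (R₁ *ₚ (E₂ ^ₚ k)) ∼ (R₂ *ₚ (E₁ ^ₚ k))
    cross′ = *ₚ-cancelʳ _ _ G^k crossG (monic⇒nonzero (monic-^ₚ G k mG))
      where
      crossG : ((R₁ *ₚ (E₂ ^ₚ k)) *ₚ G^k) ∼ ((R₂ *ₚ (E₁ ^ₚ k)) *ₚ G^k)
      crossG = ∼-trans (*ₚ-assoc R₁ _ G^k) (∼-trans (*ₚ-congˡ R₁ (∼-sym (D^k∼ E₂G∼D₂)))
                 (∼-trans cross (∼-trans (*ₚ-congˡ R₂ (D^k∼ E₁G∼D₁)) (∼-sym (*ₚ-assoc R₂ _ G^k)))))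
    E₁∼1 : E₁ ∼ oneₚ
    E₁∼1 = kCoprime-monic-divisor k kc₁ mE₁
      (coprime-∣*ₚ⇒∣ (coprime-^ₚ-^ₚ cop k) (R₂ , ∼-trans (∼-sym cross′) (*ₚ-comm R₁ _))) (E^k∣D^k E₁G∼D₁)
    E₂∼1 : E₂ ∼ oneₚ
    E₂∼1 = kCoprime-monic-divisor k kc₂ mE₂
      (coprime-∣*ₚ⇒∣ (coprime-^ₚ-^ₚ (coprime-sym cop) k) (R₁ , ∼-trans cross′ (*ₚ-comm R₂ _))) (E^k∣D^k E₂G∼D₂)
    D∼G : ∀ {E D} → (E *ₚ G) ∼ D → E ∼ oneₚ → D ∼ G
    D∼G EG∼D E∼1 = ∼-trans (∼-sym EG∼D) (∼-trans (*ₚ-congʳ G E∼1) (*ₚ-identityˡ G))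

  tDiff : Pol → Pol → Pol → Pol → Pol → Carrier
  tDiff M₁ M₂ R₁ R₂ A = t M₁ (A *ₚ R₁) + - t M₂ (A *ₚ R₂)

  VanishesOnMonomials : ℕ → (Pol → Carrier) → Set
  VanishesOnMonomials N φ = ∀ j → j < N → φ (x^ j) ≡ 0#

  -- A functional that only depends on A modulo H is determined by its values on 1, x, …, x^(deg H - 1).
  vanishesOnMonomials⇒t≡ : ∀ H M₁ M₂ R₁ R₂ → 0 < len H → M₁ ∣∼ H → M₂ ∣∼ H →
    VanishesOnMonomials (deg H) (tDiff M₁ M₂ R₁ R₂) → ∀ A → t M₁ (A *ₚ R₁) ≡ t M₂ (A *ₚ R₂)
  vanishesOnMonomials⇒t≡ H M₁ M₂ R₁ R₂ pos M₁∣H M₂∣H van A =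
    𝔽.x∙y⁻¹≈ε⇒x≈y _ _ (trans tDiff-rem (isLinear-vanishes tDiff-isLinear (deg H) (rem A H) v van))
    where
    tDiff-isLinear : IsLinear (tDiff M₁ M₂ R₁ R₂)
    tDiff-isLinear = isLinear-− (t-isLinear M₁ R₁) (t-isLinear M₂ R₂)
    tDiff-rem : tDiff M₁ M₂ R₁ R₂ A ≡ tDiff M₁ M₂ R₁ R₂ (rem A H)
    tDiff-rem = cong₂ (λ x y → x + - y) (t-rem-divisor M₁ R₁ H A pos M₁∣H) (t-rem-divisor M₂ R₂ H A pos M₂∣H)
    v : VanishesFrom (deg H) (rem A H)
    v with len H | remainder-short (proj₂ (rem-isQuotRem H pos A))
    ... | suc h | r<H = len<⇒vanishesFrom (rem A H) r<H

  separation : ∀ k H D₁ D₂ R₁ R₂ → ¬ IsZero H → Monic D₁ → Monic D₂ → D₁ ∣ₚ H → D₂ ∣ₚ H →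
    length R₁ ≡ deg (D₁ ^ₚ k) → length R₂ ≡ deg (D₂ ^ₚ k) →
    kCoprime k R₁ (D₁ ^ₚ k) → kCoprime k R₂ (D₂ ^ₚ k) →
    VanishesOnMonomials (deg (H ^ₚ k)) (tDiff (D₁ ^ₚ k) (D₂ ^ₚ k) R₁ R₂) → (D₁ ∼ D₂) × (R₁ ≡ R₂)
  separation k H D₁ D₂ R₁ R₂ H≉0 m₁ m₂ D₁∣H D₂∣H l₁ l₂ kc₁ kc₂ van = D₁∼D₂ , R₁≡R₂
    where
    M₁ = D₁ ^ₚ k
    M₂ = D₂ ^ₚ k
    mM₁ = monic-^ₚ D₁ k m₁
    mM₂ = monic-^ₚ D₂ k m₂
    0<len-H^k : 0 < len (H ^ₚ k)
    0<len-H^k = subst (0 <_) (sym (len-^ₚ H (proj₂ (¬IsZero⇒len≡suc H H≉0)) k)) (s≤s z≤n)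
    t≡ : ∀ A → t M₁ (A *ₚ R₁) ≡ t M₂ (A *ₚ R₂)
    t≡ = vanishesOnMonomials⇒t≡ (H ^ₚ k) M₁ M₂ R₁ R₂ 0<len-H^k (∣ₚ-^ₚ k D₁∣H) (∣ₚ-^ₚ k D₂∣H) van
    cross : (R₁ *ₚ M₂) ∼ (R₂ *ₚ M₁)
    cross = cross-multiply-from-t M₁ M₂ R₁ R₂ mM₁ mM₂
      (subst (λ n → VanishesFrom n R₁) l₁ (vanishesFrom-length R₁))
      (subst (λ n → VanishesFrom n R₂) l₂ (vanishesFrom-length R₂)) t≡
    D₁∼D₂ : D₁ ∼ D₂
    D₁∼D₂ = kCoprime-cross⇒∼ k D₁ D₂ R₁ R₂ m₁ m₂ kc₁ kc₂ cross
    M₁∼M₂ : M₁ ∼ M₂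
    M₁∼M₂ = ^ₚ-cong k D₁∼D₂
    R₁≡R₂ : R₁ ≡ R₂
    R₁≡R₂ = ∼-sameLength⇒≡ R₁ R₂ (trans l₁ (trans (cong (_∸ 1) (len-cong M₁∼M₂)) (sym l₂)))
      (*ₚ-cancelʳ R₁ R₂ M₁ (∼-trans (*ₚ-congˡ R₁ M₁∼M₂) cross) (monic⇒nonzero mM₁))

module FiniteSums {c ℓ} (R : CommutativeRing c ℓ) where
  open CommutativeRing R
  open SetoidReasoning setoid
  module R+ = CommutativeSemigroupProperties +-commutativeSemigroup

  ∑ : ∀ {A : Set} → List A → (A → Carrier) → Carrier
  ∑ L f = foldr _+_ 0# (map f L)

  ∑-cong : ∀ {A : Set} (L : List A) {f g : A → Carrier} → (∀ {x} → x ∈ L → f x ≈ g x) → ∑ L f ≈ ∑ L g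
  ∑-cong [] f≈g = refl
  ∑-cong (x ∷ L) f≈g = +-cong (f≈g (here ≡.refl)) (∑-cong L (λ x∈L → f≈g (there x∈L)))

  ∑-zero : ∀ {A : Set} (L : List A) {f : A → Carrier} → (∀ {x} → x ∈ L → f x ≈ 0#) → ∑ L f ≈ 0#
  ∑-zero [] f≈0 = refl
  ∑-zero (x ∷ L) f≈0 = trans (+-cong (f≈0 (here ≡.refl)) (∑-zero L (λ x∈L → f≈0 (there x∈L)))) (+-identityˡ 0#)

  ∑-+ : ∀ {A : Set} (L : List A) (f g : A → Carrier) → ∑ L (λ x → f x + g x) ≈ ∑ L f + ∑ L g
  ∑-+ [] f g = sym (+-identityˡ 0#)
  ∑-+ (x ∷ L) f g = trans (+-congˡ (∑-+ L f g)) (R+.interchange (f x) (g x) (∑ L f) (∑ L g))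

  *-distribˡ-∑ : ∀ {A : Set} (L : List A) (k : Carrier) (f : A → Carrier) → k * ∑ L f ≈ ∑ L (λ x → k * f x)
  *-distribˡ-∑ [] k f = zeroʳ k
  *-distribˡ-∑ (x ∷ L) k f = trans (distribˡ k (f x) (∑ L f)) (+-congˡ (*-distribˡ-∑ L k f))

  *-distribʳ-∑ : ∀ {A : Set} (L : List A) (k : Carrier) (f : A → Carrier) → ∑ L f * k ≈ ∑ L (λ x → f x * k)
  *-distribʳ-∑ [] k f = zeroˡ k
  *-distribʳ-∑ (x ∷ L) k f = trans (distribʳ k (f x) (∑ L f)) (+-congˡ (*-distribʳ-∑ L k f))

  ∑-*-∑ : ∀ {A B : Set} (L₁ : List A) (L₂ : List B) f g →
          ∑ L₁ f * ∑ L₂ g ≈ ∑ L₁ (λ x → ∑ L₂ (λ y → f x * g y))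
  ∑-*-∑ L₁ L₂ f g = trans (*-distribʳ-∑ L₁ _ f) (∑-cong L₁ (λ {x} _ → *-distribˡ-∑ L₂ (f x) g))

  ∑-swap : ∀ {A B : Set} (L₁ : List A) (L₂ : List B) (f : A → B → Carrier) →
           ∑ L₁ (λ a → ∑ L₂ (f a)) ≈ ∑ L₂ (λ b → ∑ L₁ (λ a → f a b))
  ∑-swap [] L₂ f = sym (∑-zero L₂ (λ _ → refl))
  ∑-swap (a ∷ L₁) L₂ f = trans (+-congˡ (∑-swap L₁ L₂ f)) (sym (∑-+ L₂ (f a) (λ b → ∑ L₁ (λ a → f a b))))

  ∑-++ : ∀ {A : Set} (xs ys : List A) (f : A → Carrier) → ∑ (xs ++ ys) f ≈ ∑ xs f + ∑ ys f
  ∑-++ [] ys f = sym (+-identityˡ _)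
  ∑-++ (x ∷ xs) ys f = trans (+-congˡ (∑-++ xs ys f)) (sym (+-assoc _ _ _))

  ∑-concatMap : ∀ {A B : Set} (L : List A) (g : A → List B) (f : B → Carrier) →
                ∑ (concatMap g L) f ≈ ∑ L (λ a → ∑ (g a) f)
  ∑-concatMap [] g f = refl
  ∑-concatMap (a ∷ L) g f = trans (∑-++ (g a) (concatMap g L) f) (+-congˡ (∑-concatMap L g f))

  ∑-map : ∀ {A B : Set} (L : List A) (g : A → B) (f : B → Carrier) → ∑ (map g L) f ≡ ∑ L (λ x → f (g x))
  ∑-map L g f = ≡.cong (foldr _+_ 0#) (≡.sym (Listₚ.map-∘ L))

  ∑-delta : ∀ {A : Set} (L : List A) {x : A} (h : A → Carrier) → Unique L → x ∈ L →
            (∀ {y} → y ∈ L → y ≢ x → h y ≈ 0#) → ∑ L h ≈ h x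
  ∑-delta (y ∷ L) h (y∉L ∷ u) (here ≡.refl) h≈0 =
    trans (+-congˡ (∑-zero L (λ w∈L → h≈0 (there w∈L) (λ w≡y → All.lookup y∉L w∈L (≡.sym w≡y))))) (+-identityʳ _)
  ∑-delta (y ∷ L) h (y∉L ∷ u) (there x∈L) h≈0 =
    trans (+-cong (h≈0 (here ≡.refl) (λ y≡x → All.lookup y∉L x∈L y≡x)) (∑-delta L h u x∈L (λ w∈L → h≈0 (there w∈L))))
          (+-identityˡ _)

module AdditiveCharacters {c ℓ} (F : FiniteField) (R : CommutativeRing c ℓ)
  (λ' : FiniteField.Carrier F → CommutativeRing.Carrier R)
  (ID : IntegralDomain R) (NC : NontrivialAdditiveCharacter F R λ') where
  open CommutativeRing R
  open SetoidReasoning setoid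
  open FiniteSums R
  open CharSums F R λ' using (fromℕ)
  open NontrivialAdditiveCharacter NC
  open IntegralDomain ID
  open PolynomialAlgebra F using (IsLinear; isLinear-0∷; isLinear-[]; isLinear-∷; VanishesOnMonomials; x^)
  open Poly F using (oneₚ; allVecs)
  module FF = FiniteField F
  module 𝔽 = PolynomialAlgebra.𝔽 F
  module RP = RingProperties ring
  module Mult = Algebra.Properties.Semiring.Mult semiring

  fromℕ≈×1# : ∀ n → fromℕ n ≈ n Mult.× 1#
  fromℕ≈×1# zero = refl
  fromℕ≈×1# (suc n) = +-congˡ (fromℕ≈×1# n)

  fromℕ-* : ∀ m n → fromℕ (m ℕ.* n) ≈ fromℕ m * fromℕ n
  fromℕ-* m n = begin
    fromℕ (m ℕ.* n)           ≈⟨ fromℕ≈×1# (m ℕ.* n) ⟩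
    (m ℕ.* n) Mult.× 1#           ≈⟨ Mult.×1-homo-* m n ⟩
    (m Mult.× 1#) * (n Mult.× 1#)  ≈⟨ *-cong (fromℕ≈×1# m) (fromℕ≈×1# n) ⟨
    fromℕ m * fromℕ n         ∎

  ∑-1# : ∀ {A : Set} (L : List A) → ∑ L (λ _ → 1#) ≈ fromℕ (length L)
  ∑-1# [] = refl
  ∑-1# (x ∷ L) = +-congˡ (∑-1# L)

  λ-cong : ∀ {a b} → a ≡ b → λ' a ≈ λ' b
  λ-cong e = reflexive (≡.cong λ' e)

  select : {P : Set} → Dec P → Carrier → Carrier
  select (yes _) r = r
  select (no _) _ = 0#

  -- Double counting: Σ_a f(σ a) = Σ_a Σ_b [b = σ a] f b = Σ_b Σ_a [b = σ a] f b = Σ_b f b.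
  ∑-bijection : ∀ (σ τ : FF.Carrier → FF.Carrier) → (∀ b → σ (τ b) ≡ b) → (∀ a → τ (σ a) ≡ a) →
    (f : FF.Carrier → Carrier) → ∑ FF.elements (λ a → f (σ a)) ≈ ∑ FF.elements f
  ∑-bijection σ τ στ τσ f = begin
    ∑ E (λ a → f (σ a))                          ≈⟨ ∑-cong E (λ {a} _ → sym (trans (∑-delta E _ FF.unique (FF.complete (σ a)) (≢σa a)) (selected a))) ⟩
    ∑ E (λ a → ∑ E (λ b → [ b ≟σ a ] f b))       ≈⟨ ∑-swap E E (λ a b → [ b ≟σ a ] f b) ⟩
    ∑ E (λ b → ∑ E (λ a → [ b ≟σ a ] f b))       ≈⟨ ∑-cong E (λ {b} _ → trans (∑-delta E _ FF.unique (FF.complete (τ b)) (≢τb b)) (selected′ b)) ⟩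
    ∑ E f                                        ∎
    where
    E = FF.elements
    [_≟σ_]_ : FF.Carrier → FF.Carrier → Carrier → Carrier
    [ b ≟σ a ] r = select (b FF.≟ σ a) r
    selected : ∀ a → [ σ a ≟σ a ] f (σ a) ≈ f (σ a)
    selected a with σ a FF.≟ σ a
    ... | yes _ = refl
    ... | no ne = ⊥-elim (ne ≡.refl)
    ≢σa : ∀ a {b} → b ∈ E → b ≢ σ a → [ b ≟σ a ] f b ≈ 0#
    ≢σa a {b} _ ne with b FF.≟ σ a
    ... | yes e = ⊥-elim (ne e)
    ... | no _ = refl
    selected′ : ∀ b → [ b ≟σ τ b ] f b ≈ f b
    selected′ b with b FF.≟ σ (τ b)
    ... | yes _ = refl
    ... | no ne = ⊥-elim (ne (≡.sym (στ b)))
    ≢τb : ∀ b {a} → a ∈ E → a ≢ τ b → [ b ≟σ a ] f b ≈ 0#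
    ≢τb b {a} _ ne with b FF.≟ σ a
    ... | yes e = ⊥-elim (ne (≡.trans (≡.sym (τσ a)) (≡.cong τ (≡.sym e))))
    ... | no _ = refl

  -- λ a₀ ≉ 1 and λ a₀ · Σ λ = Σ λ, so (λ a₀ - 1) · Σ λ = 0 in a domain.
  ∑-λ≈0 : ∑ FF.elements λ' ≈ 0#
  ∑-λ≈0 with nontrivial
  ... | a₀ , λa₀≉1 with noZeroDivisors (λ' a₀ - 1#) S [λa₀-1]S≈0
    where
    S = ∑ FF.elements λ'
    λa₀S≈S : λ' a₀ * S ≈ S
    λa₀S≈S = begin
      λ' a₀ * S                                ≈⟨ *-distribˡ-∑ FF.elements (λ' a₀) λ' ⟩
      ∑ FF.elements (λ b → λ' a₀ * λ' b)       ≈⟨ ∑-cong FF.elements (λ {b} _ → sym (hom-+ a₀ b)) ⟩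
      ∑ FF.elements (λ b → λ' (a₀ FF.+ b))     ≈⟨ ∑-bijection (a₀ FF.+_) (FF.- a₀ FF.+_) (𝔽.\\-leftDividesˡ a₀) (𝔽.\\-leftDividesʳ a₀) λ' ⟩
      S                                        ∎
    [λa₀-1]S≈0 : (λ' a₀ - 1#) * S ≈ 0#
    [λa₀-1]S≈0 = begin
      (λ' a₀ - 1#) * S                         ≈⟨ RP.[y-z]x≈yx-zx S (λ' a₀) 1# ⟩
      λ' a₀ * S - 1# * S                       ≈⟨ +-cong λa₀S≈S (-‿cong (*-identityˡ S)) ⟩
      S - S                                    ≈⟨ -‿inverseʳ S ⟩
      0#                                       ∎
  ... | inj₂ S≈0 = S≈0
  ... | inj₁ λa₀-1≈0 = ⊥-elim (λa₀≉1 (RP.x∙y⁻¹≈ε⇒x≈y _ _ λa₀-1≈0))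

  ∑-λ-*≈0 : ∀ k → k ≢ FF.0# → ∑ FF.elements (λ a → λ' (a FF.* k)) ≈ 0#
  ∑-λ-*≈0 k k≢0 = trans (∑-bijection (FF._* k) (FF._* (k FF.⁻¹)) στ τσ λ') ∑-λ≈0
    where
    στ : ∀ b → (b FF.* (k FF.⁻¹)) FF.* k ≡ b
    στ b = ≡.trans (𝔽.*-assoc b _ k) (≡.trans (≡.cong (b FF.*_) (PolynomialAlgebra.⁻¹-inverseˡ F k k≢0)) (𝔽.*-identityʳ b))
    τσ : ∀ a → (a FF.* k) FF.* (k FF.⁻¹) ≡ a
    τσ a = ≡.trans (𝔽.*-assoc a k _) (≡.trans (≡.cong (a FF.*_) (FF.⁻¹-inverse k k≢0)) (𝔽.*-identityʳ a))

  ∑-λ-*0≈q : ∑ FF.elements (λ a → λ' (a FF.* FF.0#)) ≈ fromℕ FF.q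
  ∑-λ-*0≈q = trans (∑-cong FF.elements (λ {a} _ → trans (λ-cong (𝔽.zeroʳ a)) hom-0)) (∑-1# FF.elements)

  ∑-allVecs-suc : ∀ {φ} → IsLinear φ → ∀ N →
    ∑ (allVecs (suc N)) (λ v → λ' (φ (toList v)))
      ≈ ∑ FF.elements (λ a → λ' (a FF.* φ oneₚ)) * ∑ (allVecs N) (λ w → λ' (φ (FF.0# ∷ toList w)))
  ∑-allVecs-suc {φ} L N = begin
    ∑ (allVecs (suc N)) (λ v → λ' (φ (toList v)))
      ≈⟨ ∑-concatMap FF.elements (λ a → map (a Vec.∷_) (allVecs N)) _ ⟩
    ∑ FF.elements (λ a → ∑ (map (a Vec.∷_) (allVecs N)) (λ v → λ' (φ (toList v))))
      ≈⟨ ∑-cong FF.elements (λ {a} _ → reflexive (∑-map (allVecs N) (a Vec.∷_) _)) ⟩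
    ∑ FF.elements (λ a → ∑ (allVecs N) (λ w → λ' (φ (a ∷ toList w))))
      ≈⟨ ∑-cong FF.elements (λ {a} _ → ∑-cong (allVecs N) (λ {w} _ → trans (λ-cong (isLinear-∷ L a (toList w))) (hom-+ _ _))) ⟩
    ∑ FF.elements (λ a → ∑ (allVecs N) (λ w → λ' (a FF.* φ oneₚ) * λ' (φ (FF.0# ∷ toList w))))
      ≈⟨ ∑-cong FF.elements (λ {a} _ → sym (*-distribˡ-∑ (allVecs N) _ _)) ⟩
    ∑ FF.elements (λ a → λ' (a FF.* φ oneₚ) * ∑ (allVecs N) (λ w → λ' (φ (FF.0# ∷ toList w))))
      ≈⟨ *-distribʳ-∑ FF.elements _ _ ⟨
    ∑ FF.elements (λ a → λ' (a FF.* φ oneₚ)) * ∑ (allVecs N) (λ w → λ' (φ (FF.0# ∷ toList w))) ∎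

  -- Summing λ ∘ φ over the q^N coefficient vectors of length N: since φ(a₀ + a₁x + …) = a₀ φ(1) + …,
  -- the sum factors into one-variable sums, each q or 0.
  ∑-λ-linear : ∀ {φ} → IsLinear φ → ∀ N →
      (VanishesOnMonomials N φ × ∑ (allVecs N) (λ v → λ' (φ (toList v))) ≈ fromℕ (FF.q ℕ.^ N))
    ⊎ (¬ VanishesOnMonomials N φ × ∑ (allVecs N) (λ v → λ' (φ (toList v))) ≈ 0#)
  ∑-λ-linear L zero = inj₁ ((λ j ()) , +-cong (trans (λ-cong (isLinear-[] L)) hom-0) refl)
  ∑-λ-linear {φ} L (suc N) with φ oneₚ FF.≟ FF.0# | ∑-λ-linear (isLinear-0∷ L) N
  ... | no φ1≢0 | _ = inj₂ ((λ van → φ1≢0 (van 0 (s≤s z≤n))) ,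
                          trans (∑-allVecs-suc L N) (trans (*-congʳ (∑-λ-*≈0 _ φ1≢0)) (zeroˡ _)))
  ... | yes φ1≡0 | inj₂ (¬van , S≈0) = inj₂ ((λ van → ¬van (λ j j<N → van (suc j) (s≤s j<N))) ,
                          trans (∑-allVecs-suc L N) (trans (*-congˡ S≈0) (zeroʳ _)))
  ... | yes φ1≡0 | inj₁ (van , S≈q^N) = inj₁ (van′ , trans (∑-allVecs-suc L N)
                          (trans (*-cong ∑≈q S≈q^N) (sym (fromℕ-* FF.q (FF.q ℕ.^ N)))))
    where
    ∑≈q : ∑ FF.elements (λ a → λ' (a FF.* φ oneₚ)) ≈ fromℕ FF.q
    ∑≈q = trans (∑-cong FF.elements (λ {a} _ → λ-cong (≡.cong (a FF.*_) φ1≡0))) ∑-λ-*0≈q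
    van′ : VanishesOnMonomials (suc N) φ
    van′ zero _ = φ1≡0
    van′ (suc j) (s≤s j<N) = van j j<N

module ConvolutionSum {c ℓ} (F : FiniteField) (R : CommutativeRing c ℓ)
  (λ' : FiniteField.Carrier F → CommutativeRing.Carrier R)
  (ID : IntegralDomain R) (NC : NontrivialAdditiveCharacter F R λ')
  (k : ℕ) (H D₁ D₂ G : Poly.Pol F) (L₁ L₂ : List (Poly.Pol F))
  (H≉0 : ¬ Poly.IsZero F H) (m₁ : Poly.Monic F D₁) (m₂ : Poly.Monic F D₂)
  (D₁∣H : Poly._∣ₚ_ F D₁ H) (D₂∣H : Poly._∣ₚ_ F D₂ H)
  (es₁ : CharSums.IsEtaSystem F R λ' k D₁ L₁) (es₂ : CharSums.IsEtaSystem F R λ' k D₂ L₂) where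
  open CommutativeRing R
  open SetoidReasoning setoid
  open FiniteSums R
  open AdditiveCharacters F R λ' ID NC
  open CharSums F R λ' using (fromℕ; η)
  open NontrivialAdditiveCharacter NC using (hom-+)
  open Poly F using (Pol; _*ₚ_; _^ₚ_; _-ₚ_; _≈ₚ_; residues; allVecs; kCoprime; deg; t)
  open PolynomialAlgebra F using (_∼_; tDiff; VanishesOnMonomials; separation; x^)
  module P = PolynomialAlgebra F

  M₁ = D₁ ^ₚ k
  M₂ = D₂ ^ₚ k
  N = deg (H ^ₚ k)

  ∑tDiff : Pol → Pol → Carrier
  ∑tDiff R₁ R₂ = ∑ (residues (H ^ₚ k)) (λ A → λ' (tDiff M₁ M₂ R₁ R₂ A))

  T : Pol → Pol → Carrier
  T R₁ R₂ = λ' (t M₂ (G *ₚ R₂)) * ∑tDiff R₁ R₂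

  λ-product : ∀ A R₁ R₂ →
    λ' (t M₁ (A *ₚ R₁)) * λ' (t M₂ ((G -ₚ A) *ₚ R₂)) ≈ λ' (t M₂ (G *ₚ R₂)) * λ' (tDiff M₁ M₂ R₁ R₂ A)
  λ-product A R₁ R₂ = begin
    λ' x * λ' (t M₂ ((G -ₚ A) *ₚ R₂))  ≈⟨ *-congˡ (trans (λ-cong t-G-A) (hom-+ y (FF.- z))) ⟩
    λ' x * (λ' y * λ' (FF.- z))        ≈⟨ x∙yz≈y∙xz (λ' x) (λ' y) (λ' (FF.- z)) ⟩
    λ' y * (λ' x * λ' (FF.- z))        ≈⟨ *-congˡ (hom-+ x (FF.- z)) ⟨
    λ' y * λ' (x FF.+ FF.- z)          ∎
    where
    open CommutativeSemigroupProperties *-commutativeSemigroup using (x∙yz≈y∙xz)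
    x = t M₁ (A *ₚ R₁)
    y = t M₂ (G *ₚ R₂)
    z = t M₂ (A *ₚ R₂)
    t-G-A : t M₂ ((G -ₚ A) *ₚ R₂) ≡ y FF.+ FF.- z
    t-G-A = ≡.trans (P.t-cong M₂ (P.ℙ.[y-z]x≈yx-zx R₂ G A)) (P.t-−ₚ M₂ _ _)

  convSum-expansion : convSum F R λ' k H G D₁ D₂ L₁ L₂ ≈ ∑ L₁ (λ R₁ → ∑ L₂ (λ R₂ → T R₁ R₂))
  convSum-expansion = begin
    ∑ Res (λ A → ∑ L₁ (λ R₁ → λ' (t M₁ (A *ₚ R₁))) * ∑ L₂ (λ R₂ → λ' (t M₂ ((G -ₚ A) *ₚ R₂))))
      ≈⟨ ∑-cong Res (λ _ → ∑-*-∑ L₁ L₂ _ _) ⟩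
    ∑ Res (λ A → ∑ L₁ (λ R₁ → ∑ L₂ (λ R₂ → λ' (t M₁ (A *ₚ R₁)) * λ' (t M₂ ((G -ₚ A) *ₚ R₂)))))
      ≈⟨ ∑-cong Res (λ {A} _ → ∑-cong L₁ (λ {R₁} _ → ∑-cong L₂ (λ {R₂} _ → λ-product A R₁ R₂))) ⟩
    ∑ Res (λ A → ∑ L₁ (λ R₁ → ∑ L₂ (λ R₂ → λ' (t M₂ (G *ₚ R₂)) * λ' (tDiff M₁ M₂ R₁ R₂ A))))
      ≈⟨ ∑-swap Res L₁ _ ⟩
    ∑ L₁ (λ R₁ → ∑ Res (λ A → ∑ L₂ (λ R₂ → λ' (t M₂ (G *ₚ R₂)) * λ' (tDiff M₁ M₂ R₁ R₂ A))))
      ≈⟨ ∑-cong L₁ (λ _ → ∑-swap Res L₂ _) ⟩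
    ∑ L₁ (λ R₁ → ∑ L₂ (λ R₂ → ∑ Res (λ A → λ' (t M₂ (G *ₚ R₂)) * λ' (tDiff M₁ M₂ R₁ R₂ A))))
      ≈⟨ ∑-cong L₁ (λ _ → ∑-cong L₂ (λ _ → sym (*-distribˡ-∑ Res _ _))) ⟩
    ∑ L₁ (λ R₁ → ∑ L₂ (λ R₂ → T R₁ R₂)) ∎
    where Res = residues (H ^ₚ k)

  ∑tDiff-cases : ∀ R₁ R₂ →
      (VanishesOnMonomials N (tDiff M₁ M₂ R₁ R₂) × ∑tDiff R₁ R₂ ≈ fromℕ (FF.q ℕ.^ N))
    ⊎ (¬ VanishesOnMonomials N (tDiff M₁ M₂ R₁ R₂) × ∑tDiff R₁ R₂ ≈ 0#)
  ∑tDiff-cases R₁ R₂ with ∑-λ-linear (P.isLinear-− (P.t-isLinear M₁ R₁) (P.t-isLinear M₂ R₂)) N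
  ... | inj₁ (van , S≈) = inj₁ (van , trans (reflexive (∑-map (allVecs N) toList _)) S≈)
  ... | inj₂ (¬van , S≈0) = inj₂ (¬van , trans (reflexive (∑-map (allVecs N) toList _)) S≈0)

  length-residue : ∀ {r} M → r ∈ residues M → length r ≡ deg M
  length-residue M r∈ with ∈-map⁻ toList r∈
  ... | v , _ , ≡.refl = Vecₚ.length-toList v

  reduced : ∀ {D L r} → CharSums.IsEtaSystem F R λ' k D L → r ∈ L →
            (length r ≡ deg (D ^ₚ k)) × kCoprime k r (D ^ₚ k)
  reduced {D} es r∈L with Equivalence.to (proj₂ es _) r∈L
  ... | r∈res , kc = length-residue (D ^ₚ k) r∈res , kc

  T≈0 : ∀ {R₁ R₂} → R₁ ∈ L₁ → R₂ ∈ L₂ → ¬ ((D₁ ∼ D₂) × (R₁ ≡ R₂)) → T R₁ R₂ ≈ 0#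
  T≈0 {R₁} {R₂} R₁∈ R₂∈ ≠ with ∑tDiff-cases R₁ R₂
  ... | inj₂ (_ , S≈0) = trans (*-congˡ S≈0) (zeroʳ _)
  ... | inj₁ (van , _) = ⊥-elim (≠ (separation k H D₁ D₂ R₁ R₂ H≉0 m₁ m₂ D₁∣H D₂∣H
          (proj₁ (reduced es₁ R₁∈)) (proj₁ (reduced es₂ R₂∈)) (proj₂ (reduced es₁ R₁∈)) (proj₂ (reduced es₂ R₂∈)) van))

  convSum-≉ : ¬ (D₁ ≈ₚ D₂) → convSum F R λ' k H G D₁ D₂ L₁ L₂ ≈ 0#
  convSum-≉ D₁≉D₂ = trans convSum-expansion
    (∑-zero L₁ (λ R₁∈ → ∑-zero L₂ (λ R₂∈ → T≈0 R₁∈ R₂∈ (λ (D₁∼D₂ , _) → D₁≉D₂ (P.∼⇒≈ₚ D₁∼D₂)))))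

  convSum-≈ : D₁ ≈ₚ D₂ → convSum F R λ' k H G D₁ D₂ L₁ L₂ ≈ fromℕ (FF.q ℕ.^ N) * η k L₁ G D₁
  convSum-≈ D₁≈D₂ = trans convSum-expansion (trans (∑-cong L₁ diagonal) (sym (*-distribˡ-∑ L₁ _ _)))
    where
    M₁∼M₂ : M₁ ∼ M₂
    M₁∼M₂ = P.^ₚ-cong k (P.≈ₚ⇒∼ D₁≈D₂)
    L₁⊆L₂ : ∀ {r} → r ∈ L₁ → r ∈ L₂
    L₁⊆L₂ {r} r∈L₁ with Equivalence.to (proj₂ es₁ _) r∈L₁
    ... | r∈res , kc = Equivalence.from (proj₂ es₂ _)
      ( ≡.subst (λ n → r ∈ map toList (allVecs n)) (≡.cong (ℕ._∸ 1) (≡.cong length (P.∼⇒≈ₚ M₁∼M₂))) r∈res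
      , λ C mC C^k∣r (Q , e) → kc C mC C^k∣r (Q , ≡.trans e (≡.sym (P.∼⇒≈ₚ M₁∼M₂))))
    T-diagonal : ∀ R₁ → T R₁ R₁ ≈ λ' (t M₂ (G *ₚ R₁)) * fromℕ (FF.q ℕ.^ N)
    T-diagonal R₁ with ∑tDiff-cases R₁ R₁
    ... | inj₁ (_ , S≈) = *-congˡ S≈
    ... | inj₂ (¬van , _) = ⊥-elim (¬van λ j _ →
            ≡.trans (≡.cong (FF._+ FF.- t M₂ (x^ j *ₚ R₁)) (P.t-congᴹ _ M₁∼M₂)) (P.𝔽.-‿inverseʳ _))
    diagonal : ∀ {R₁} → R₁ ∈ L₁ → ∑ L₂ (T R₁) ≈ fromℕ (FF.q ℕ.^ N) * λ' (t M₁ (G *ₚ R₁))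
    diagonal {R₁} R₁∈ = begin
      ∑ L₂ (T R₁)                                  ≈⟨ ∑-delta L₂ (T R₁) (proj₁ es₂) (L₁⊆L₂ R₁∈) (λ R₂∈ ≢ → T≈0 R₁∈ R₂∈ (λ (_ , e) → ≢ (≡.sym e))) ⟩
      T R₁ R₁                                      ≈⟨ T-diagonal R₁ ⟩
      λ' (t M₂ (G *ₚ R₁)) * fromℕ (FF.q ℕ.^ N)     ≈⟨ *-comm _ _ ⟩
      fromℕ (FF.q ℕ.^ N) * λ' (t M₂ (G *ₚ R₁))     ≈⟨ *-congˡ (λ-cong (P.t-congᴹ _ M₁∼M₂)) ⟨
      fromℕ (FF.q ℕ.^ N) * λ' (t M₁ (G *ₚ R₁))     ∎

lemma4p1 : ∀ {c ℓ} (F : FiniteField) (R : CommutativeRing c ℓ) → IntegralDomain R →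
    (λ' : FiniteField.Carrier F → CommutativeRing.Carrier R) →
    NontrivialAdditiveCharacter F R λ' →
    (k : ℕ) → 1 ≤ k →
    (H : Poly.Pol F) → ¬ Poly.IsZero F H →
    (D₁ D₂ : Poly.Pol F) → Poly.Monic F D₁ → Poly.Monic F D₂ →
    Poly._∣ₚ_ F D₁ H → Poly._∣ₚ_ F D₂ H →
    (G : Poly.Pol F) →
    (L₁ L₂ : List (Poly.Pol F)) →
    CharSums.IsEtaSystem F R λ' k D₁ L₁ → CharSums.IsEtaSystem F R λ' k D₂ L₂ →
    (Poly._≈ₚ_ F D₁ D₂ →
       CommutativeRing._≈_ R (convSum F R λ' k H G D₁ D₂ L₁ L₂)
         (CommutativeRing._*_ R (CharSums.fromℕ F R λ' (Poly.∣_∣ₚ F H ^ k))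
                                (CharSums.η F R λ' k L₁ G D₁)))
    × (¬ Poly._≈ₚ_ F D₁ D₂ →
       CommutativeRing._≈_ R (convSum F R λ' k H G D₁ D₂ L₁ L₂) (CommutativeRing.0# R))
lemma4p1 F R ID λ' NC k _ H H≉0 D₁ D₂ m₁ m₂ D₁∣H D₂∣H G L₁ L₂ es₁ es₂ =
  (λ D₁≈D₂ → ≡.subst (λ n → convSum F R λ' k H G D₁ D₂ L₁ L₂ ≈ fromℕ n * η k L₁ G D₁)
                     (PolynomialAlgebra.∣^ₚ∣ F H k H≉0) (convSum-≈ D₁≈D₂))
  , convSum-≉
  where
  open CommutativeRing R using (_≈_; _*_)
  open CharSums F R λ' using (fromℕ; η)
  open ConvolutionSum F R λ' ID NC k H D₁ D₂ G L₁ L₂ H≉0 m₁ m₂ D₁∣H D₂∣H es₁ es₂
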